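{- For every $n\ge1$, the number of hypoplactic congruence classes of words that contain a parking function of length $n$ (equivalently, the number of parking quasi-ribbons of size $n$, i.e. the dimension of the degree-$n$ component of the Schröder Hopf algebra $\mathbf{SQSym}$) equals $$s_n=\frac{1}{2n+2}\sum_{k=0}^n\binom{n+1}{k}\binom{2n-k}{n-k},$$ the little Schröder number, whose generating function is $\sum_{n\ge0}s_nt^n=\frac{1+t-\sqrt{1-6t+t^2}}{4t}=1+t+3t^2+11t^3+45t^4+\cdots$.
   Context: A parking function of length $n$ is a word $a=a_1\cdots a_n$ with letters in $\{1,\dots,n\}$ whose nondecreasing rearrangement $a'_1\le\cdots\le a'_n$ satisfies $a'_i\le i$ for all $i$. The hypoplactic congruence on words over the positive integers (Novelli; Krob–Thibon) can be described as follows: two words $w,w'$ are hypoplactically congruent iff they have the same multiset of letters and the inverses of their standardizations have the same descent set. Here the standardization $\mathrm{Std}(w)$ of a word of length $n$ is the permutation obtained by numbering the letters $1,\dots,n$ in increasing order of value, equal letters being numbered from left to right; the descent set of a permutation $\sigma$ is $\{i:\sigma(i)>\sigma(i+1)\}$. Since congruent words have the same letters, a class containing a parking function consists only of parking functions. -}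

module Defs where

open import Data.Nat using (ℕ; zero; suc; _+_; _*_; _≤_; _<_; _<?_; _/_)
open import Data.Nat.Properties using (_≟_)
open import Data.Nat.Combinatorics using (_C_)
open import Data.Fin using (Fin; toℕ)
open import Data.Vec using (Vec; lookup; tabulate; toList; count; allFin)
open import Data.List using (List; map; upTo)
open import Data.Nat.ListAction using (sum)
open import Data.List.Relation.Binary.Permutation.Propositional using (_↭_)
open import Data.Product using (Σ; ∃; _×_)
open import Relation.Binary.PropositionalEquality using (_≡_)
open import Relation.Nullary.Decidable using (_×-dec_)
open import Function.Bundles using (_⇔_)

-- Words of length n over the positive integers are vectors of naturals
-- (positivity is imposed where needed, e.g. for parking functions).
Word : ℕ → Set
Word n = Vec ℕ n

SameLetters : ∀ {n} → Word n → Word n → Set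
SameLetters s w = toList s ↭ toList w

Nondecreasing : ∀ {n} → Word n → Set
Nondecreasing {n} s = (i j : Fin n) → toℕ i ≤ toℕ j → lookup s i ≤ lookup s j

-- Parking function of length n: letters in {1,…,n} and the nondecreasing
-- rearrangement a'_1 ≤ … ≤ a'_n satisfies a'_i ≤ i (indices 1-based; Fin is 0-based).
IsParking : (n : ℕ) → Word n → Set
IsParking n w =
  ((i : Fin n) → 1 ≤ lookup w i × lookup w i ≤ n) ×
  Σ (Word n) λ s → SameLetters s w × Nondecreasing s ×
    ((i : Fin n) → lookup s i ≤ suc (toℕ i))

std : ∀ {n} → Word n → Vec ℕ n
std {n} w = tabulate λ p →
  suc (count (λ j → lookup w j <? lookup w p) (allFin n)
       + count (λ j → (toℕ j <? toℕ p) ×-dec (lookup w j ≟ lookup w p)) (allFin n))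

-- i ∈ Des(Std(w)⁻¹)  iff  Std(w)⁻¹(i) > Std(w)⁻¹(i+1), i.e. the position p
-- holding value i lies to the right of the position q holding value i+1.
InvDescent : ∀ {n} → Word n → ℕ → Set
InvDescent {n} w i = Σ (Fin n) λ p → Σ (Fin n) λ q →
  lookup (std w) p ≡ i × lookup (std w) q ≡ suc i × toℕ q < toℕ p

Hypo : ∀ {n} → Word n → Word n → Set
Hypo w w' = SameLetters w w' × ((i : ℕ) → InvDescent w i ⇔ InvDescent w' i)

schroeder : ℕ → ℕ
schroeder n =
  sum (map (λ k → ((suc n) C k) * (((n + n) Data.Nat.∸ k) C (n Data.Nat.∸ k))) (upTo (suc n)))
    / suc (suc (n + n))

-- Read on letters, i is an inverse descent of Std(w) exactly when the letter a with
-- i letters ≤ a and the next larger letter b of w form an inversion (some b to the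
-- left of some a). So a hypoplactic class is determined by its multiset of letters
-- and one bit for each pair of value-adjacent letters, and every such datum is
-- realised, by inserting the letters in increasing order at the front or the back.
-- For parking functions the multiset is a sequence 1 = a₁ ≤ … ≤ aₙ with aᵢ ≤ i;
-- writing it as n − 1 steps (stay, or climb by 1 + e with e at most the current
-- slack, in one of two colours) makes the classes lattice paths counted by
-- paths (n − 1) 0. Lagrange inversion for τ = t(1 + τ)/(1 − τ) identifies that
-- count with [xⁿ] ((1 + x)/(1 − x))ⁿ⁺¹ / (2n + 2), which is the
-- binomial sum defining the little Schröder number.
module Submission where

open import Defs
open import Data.Nat using (ℕ; _≤_)
open import Data.Fin using (Fin)
open import Data.Product using (Σ; ∃; _×_)
open import Relation.Binary.PropositionalEquality using (_≡_)
open import Data.Nat using (zero; suc)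
open import Data.Product using (_,_; proj₁)
open import Function using (_∘_)
open import Function.Bundles using (_↔_; Inverse)
open import Relation.Binary.PropositionalEquality using (sym; trans; cong; subst)

module Counting where

  open import Level using (Level)
  open import Data.Nat as ℕ using (ℕ; zero; suc; _≤_; _<_; z≤n; s≤s)
  import Data.Nat.Properties as ℕP
  open import Data.Fin as F using (Fin)
  import Data.Fin.Properties as FP
  open import Data.Vec using (tabulate; count; allFin)
  open import Data.Bool using (true; false)
  open import Data.Empty using (⊥-elim)
  open import Function using (id; _∘_)
  open import Relation.Nullary using (¬_; yes; no; does)
  open import Relation.Nullary.Decidable using (_⊎-dec_)
  open import Relation.Unary using (Pred; Decidable)
  open import Relation.Binary.PropositionalEquality

  private variable ℓ ℓ′ : Level

  countFin : ∀ n {P : Pred (Fin n) ℓ} → Decidable P → ℕ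
  countFin zero P? = 0
  countFin (suc n) P? with does (P? F.zero)
  ... | true = suc (countFin n (P? ∘ F.suc))
  ... | false = countFin n (P? ∘ F.suc)

  count-tabulate : ∀ {A : Set} {P : Pred A ℓ} (P? : Decidable P) n (f : Fin n → A) →
    count P? (tabulate f) ≡ countFin n (λ i → P? (f i))
  count-tabulate P? zero f = refl
  count-tabulate P? (suc n) f with does (P? (f F.zero))
  ... | true = cong suc (count-tabulate P? n (f ∘ F.suc))
  ... | false = count-tabulate P? n (f ∘ F.suc)

  count-allFin : ∀ n {P : Pred (Fin n) ℓ} (P? : Decidable P) → count P? (allFin n) ≡ countFin n P?
  count-allFin n P? = count-tabulate P? n id

  countFin-mono : ∀ n {P : Pred (Fin n) ℓ} {Q : Pred (Fin n) ℓ′} (P? : Decidable P) (Q? : Decidable Q) →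
    (∀ i → P i → Q i) → countFin n P? ≤ countFin n Q?
  countFin-mono zero P? Q? P⊆Q = z≤n
  countFin-mono (suc n) P? Q? P⊆Q with P? F.zero | Q? F.zero
  ... | yes p | yes q = s≤s (countFin-mono n _ _ (P⊆Q ∘ F.suc))
  ... | yes p | no ¬q = ⊥-elim (¬q (P⊆Q F.zero p))
  ... | no ¬p | yes q = ℕP.m≤n⇒m≤1+n (countFin-mono n _ _ (P⊆Q ∘ F.suc))
  ... | no ¬p | no ¬q = countFin-mono n _ _ (P⊆Q ∘ F.suc)

  countFin-mono-< : ∀ n {P : Pred (Fin n) ℓ} {Q : Pred (Fin n) ℓ′} (P? : Decidable P) (Q? : Decidable Q) →
    (∀ i → P i → Q i) → (y : Fin n) → Q y → ¬ P y → countFin n P? < countFin n Q?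
  countFin-mono-< (suc n) P? Q? P⊆Q F.zero qy ¬py with P? F.zero | Q? F.zero
  ... | yes p | _ = ⊥-elim (¬py p)
  ... | no _ | yes q = s≤s (countFin-mono n _ _ (P⊆Q ∘ F.suc))
  ... | no _ | no ¬q = ⊥-elim (¬q qy)
  countFin-mono-< (suc n) P? Q? P⊆Q (F.suc y) qy ¬py with P? F.zero | Q? F.zero
  ... | yes p | yes q = s≤s (countFin-mono-< n _ _ (P⊆Q ∘ F.suc) y qy ¬py)
  ... | yes p | no ¬q = ⊥-elim (¬q (P⊆Q F.zero p))
  ... | no ¬p | yes q = ℕP.m≤n⇒m≤1+n (countFin-mono-< n _ _ (P⊆Q ∘ F.suc) y qy ¬py)
  ... | no ¬p | no ¬q = countFin-mono-< n _ _ (P⊆Q ∘ F.suc) y qy ¬py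

  countFin-⊎ : ∀ n {P : Pred (Fin n) ℓ} {Q : Pred (Fin n) ℓ′} (P? : Decidable P) (Q? : Decidable Q) →
    (∀ i → P i → ¬ Q i) → countFin n (λ i → P? i ⊎-dec Q? i) ≡ countFin n P? ℕ.+ countFin n Q?
  countFin-⊎ zero P? Q? disjoint = refl
  countFin-⊎ (suc n) P? Q? disjoint with P? F.zero | Q? F.zero
  ... | yes p | yes q = ⊥-elim (disjoint F.zero p q)
  ... | yes p | no _ = cong suc (countFin-⊎ n _ _ (disjoint ∘ F.suc))
  ... | no _ | yes q = trans (cong suc (countFin-⊎ n _ _ (disjoint ∘ F.suc))) (sym (ℕP.+-suc _ _))
  ... | no _ | no _ = countFin-⊎ n _ _ (disjoint ∘ F.suc)

  countFin-⊎-≤ : ∀ n {P : Pred (Fin n) ℓ} {Q : Pred (Fin n) ℓ′} (P? : Decidable P) (Q? : Decidable Q) →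
    countFin n (λ i → P? i ⊎-dec Q? i) ≤ countFin n P? ℕ.+ countFin n Q?
  countFin-⊎-≤ zero P? Q? = z≤n
  countFin-⊎-≤ (suc n) P? Q? with P? F.zero | Q? F.zero
  ... | yes p | yes q = s≤s (ℕP.≤-trans (countFin-⊎-≤ n _ _)
                              (ℕP.≤-trans (ℕP.m≤n+m _ 1) (ℕP.≤-reflexive (sym (ℕP.+-suc _ _)))))
  ... | yes p | no _ = s≤s (countFin-⊎-≤ n _ _)
  ... | no _ | yes q = ℕP.≤-trans (s≤s (countFin-⊎-≤ n _ _)) (ℕP.≤-reflexive (sym (ℕP.+-suc _ _)))
  ... | no _ | no _ = countFin-⊎-≤ n _ _

  countFin-none : ∀ n {P : Pred (Fin n) ℓ} (P? : Decidable P) → (∀ i → ¬ P i) → countFin n P? ≡ 0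
  countFin-none zero P? ∅ = refl
  countFin-none (suc n) P? ∅ with P? F.zero
  ... | yes p = ⊥-elim (∅ F.zero p)
  ... | no _ = countFin-none n _ (∅ ∘ F.suc)

  countFin-≡-≤1 : ∀ n (y : Fin n) → countFin n (F._≟ y) ≤ 1
  countFin-≡-≤1 (suc n) F.zero with F.zero F.≟ F.zero {n}
  ... | yes _ = s≤s (ℕP.≤-reflexive (countFin-none n _ (λ i ())))
  ... | no z≢z = ⊥-elim (z≢z refl)
  countFin-≡-≤1 (suc n) (F.suc y) with F.zero F.≟ F.suc y
  ... | yes ()
  ... | no _ = ℕP.≤-trans (countFin-mono n _ _ (λ i → FP.suc-injective)) (countFin-≡-≤1 n y)

module Standardization where

  open Counting
  open import Level using (0ℓ)
  open import Data.Nat as ℕ using (ℕ; suc; _≤_; _<_; z≤n; s≤s; _<?_; _≤?_)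
  open import Data.Nat.Properties as ℕP using (_≟_)
  open import Data.Fin as F using (Fin; toℕ)
  import Data.Fin.Properties as FP
  open import Data.Vec using (Vec; []; _∷_; lookup; toList)
  import Data.Vec.Properties as VP
  import Data.List.Properties as LP
  open import Data.Vec.Membership.Propositional.Properties using (∈-lookup; ∈-toList⁺; ∈-toList⁻)
  open import Data.Vec.Relation.Unary.Any using (index)
  open import Data.Vec.Relation.Unary.Any.Properties using (lookup-index)
  open import Data.List as L using (List; length; filter)
  open import Data.List.Membership.Propositional using (_∈_)
  open import Data.List.Relation.Unary.Any using (here; there)
  open import Data.List.Relation.Binary.Sublist.Propositional using (⊆-refl)
  open import Data.List.Relation.Binary.Sublist.Propositional.Properties using (filter⁺; length-mono-≤)
  open import Data.Product using (Σ; ∃; _×_; _,_; proj₂)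
  open import Data.Sum using (_⊎_; inj₁; inj₂)
  open import Data.Empty using (⊥-elim)
  open import Data.Bool using (true; false)
  open import Relation.Nullary using (¬_; Dec; yes; no; does)
  open import Relation.Nullary.Decidable using (_⊎-dec_; _×-dec_)
  open import Relation.Unary using (Pred; Decidable)
  open import Relation.Binary.Definitions using (tri<; tri≈; tri>)
  open import Relation.Binary.PropositionalEquality

  data Inverted : List ℕ → ℕ → ℕ → Set where
    now   : ∀ {a b l} → a ∈ l → Inverted (b L.∷ l) a b
    later : ∀ {a b x l} → Inverted l a b → Inverted (x L.∷ l) a b

  countLe : ℕ → List ℕ → ℕ
  countLe a l = length (filter (_≤? a) l)

  Adjacent : List ℕ → ℕ → ℕ → Set
  Adjacent l a b = ∀ x → x ∈ l → a < x → b ≤ x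

  -- The letter form of i ∈ Des(Std(w)⁻¹): the value i of Std(w) sits on the last
  -- occurrence of the letter a with i letters ≤ a, and i + 1 on the first occurrence
  -- of the next larger letter b.
  AdjacentInversion : List ℕ → ℕ → Set
  AdjacentInversion l i =
    Σ ℕ λ a → Σ ℕ λ b → a < b × Adjacent l a b × i ≡ countLe a l × Inverted l a b

  countLe-mono : ∀ {a a′} → a ≤ a′ → ∀ l → countLe a l ≤ countLe a′ l
  countLe-mono a≤a′ l =
    length-mono-≤ (filter⁺ (_≤? _) (_≤? _) (λ { refl x≤a → ℕP.≤-trans x≤a a≤a′ }) (⊆-refl {x = l}))

  countLe-∷-yes : ∀ {a x} l → x ≤ a → countLe a (x L.∷ l) ≡ suc (countLe a l)
  countLe-∷-yes l x≤a = cong length (LP.filter-accept (_≤? _) {xs = l} x≤a)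

  countLe-∷-no : ∀ {a x} l → ¬ x ≤ a → countLe a (x L.∷ l) ≡ countLe a l
  countLe-∷-no l x≰a = cong length (LP.filter-reject (_≤? _) {xs = l} x≰a)

  countLe-mono-< : ∀ {a a′} → a < a′ → ∀ {l} → a′ ∈ l → countLe a l < countLe a′ l
  countLe-mono-< {a} {a′} a<a′ {x L.∷ l} (here refl) with x ≤? a | x ≤? a′
  ... | yes x≤a | _ = ⊥-elim (ℕP.<-irrefl refl (ℕP.<-≤-trans a<a′ x≤a))
  ... | no x≰a | yes x≤a′ rewrite countLe-∷-no l x≰a | countLe-∷-yes l x≤a′ =
    s≤s (countLe-mono (ℕP.<⇒≤ a<a′) l)
  ... | no _ | no x≰x = ⊥-elim (x≰x ℕP.≤-refl)
  countLe-mono-< {a} {a′} a<a′ {x L.∷ l} (there a′∈l) with x ≤? a | x ≤? a′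
  ... | yes x≤a | yes x≤a′ rewrite countLe-∷-yes l x≤a | countLe-∷-yes l x≤a′ =
    s≤s (countLe-mono-< a<a′ a′∈l)
  ... | yes x≤a | no x≰a′ = ⊥-elim (x≰a′ (ℕP.≤-trans x≤a (ℕP.<⇒≤ a<a′)))
  ... | no x≰a | yes x≤a′ rewrite countLe-∷-no l x≰a | countLe-∷-yes l x≤a′ =
    ℕP.m≤n⇒m≤1+n (countLe-mono-< a<a′ a′∈l)
  ... | no x≰a | no x≰a′ rewrite countLe-∷-no l x≰a | countLe-∷-no l x≰a′ =
    countLe-mono-< a<a′ a′∈l

  Inverted-∈ : ∀ {l a b} → Inverted l a b → a ∈ l × b ∈ l
  Inverted-∈ (now a∈l) = there a∈l , here refl
  Inverted-∈ (later inv) with Inverted-∈ inv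
  ... | a∈l , b∈l = there a∈l , there b∈l

  lastOccurrence : ∀ n {Q : Pred (Fin n) 0ℓ} (Q? : Decidable Q) (p : Fin n) → Q p →
    Σ (Fin n) λ p′ → Q p′ × (∀ r → Q r → toℕ r ≤ toℕ p′)
  lastOccurrence (suc n) Q? p qp with FP.any? (λ i → Q? (F.suc i))
  ... | yes (i , qi) with lastOccurrence n (λ i → Q? (F.suc i)) i qi
  ...   | p′ , qp′ , max = F.suc p′ , qp′ , λ { F.zero _ → z≤n ; (F.suc r) qr → s≤s (max r qr) }
  lastOccurrence (suc n) Q? F.zero qp | no none = F.zero , qp , λ { F.zero _ → z≤n ; (F.suc r) qr → ⊥-elim (none (r , qr)) }
  lastOccurrence (suc n) Q? (F.suc p) qp | no none = ⊥-elim (none (p , qp))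

  firstOccurrence : ∀ n {Q : Pred (Fin n) 0ℓ} (Q? : Decidable Q) (p : Fin n) → Q p →
    Σ (Fin n) λ p′ → Q p′ × (∀ r → Q r → toℕ p′ ≤ toℕ r)
  firstOccurrence (suc n) Q? p qp with Q? F.zero
  ... | yes q0 = F.zero , q0 , λ _ _ → z≤n
  firstOccurrence (suc n) Q? F.zero qp | no ¬q0 = ⊥-elim (¬q0 qp)
  firstOccurrence (suc n) Q? (F.suc p) qp | no ¬q0 with firstOccurrence n (λ i → Q? (F.suc i)) p qp
  ... | p′ , qp′ , min = F.suc p′ , qp′ , λ { F.zero q0 → ⊥-elim (¬q0 q0) ; (F.suc r) qr → s≤s (min r qr) }

  lookup∈toList : ∀ {n} (w : Vec ℕ n) p → lookup w p ∈ toList w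
  lookup∈toList w p = ∈-toList⁺ (∈-lookup p w)

  ∈toList⇒lookup : ∀ {n x} (w : Vec ℕ n) → x ∈ toList w → ∃ λ p → lookup w p ≡ x
  ∈toList⇒lookup w x∈w = index (∈-toList⁻ x∈w) , sym (lookup-index (∈-toList⁻ x∈w))

  module _ {n : ℕ} (w : Vec ℕ n) where

    countLe-toList : ∀ a → countLe a (toList w) ≡ countFin n (λ r → lookup w r ≤? a)
    countLe-toList a = go w
      where
      go : ∀ {m} (v : Vec ℕ m) → countLe a (toList v) ≡ countFin m (λ r → lookup v r ≤? a)
      go [] = refl
      go (x ∷ v) with does (x ≤? a)
      ... | true = cong suc (go v)
      ... | false = go v

    Inverted⇒positions : ∀ {a b} → Inverted (toList w) a b →
      Σ (Fin n) λ q → Σ (Fin n) λ p → toℕ q < toℕ p × lookup w q ≡ b × lookup w p ≡ a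
    Inverted⇒positions = go w
      where
      go : ∀ {m a b} (v : Vec ℕ m) → Inverted (toList v) a b →
        Σ (Fin m) λ q → Σ (Fin m) λ p → toℕ q < toℕ p × lookup v q ≡ b × lookup v p ≡ a
      go (x ∷ v) (now a∈v) with ∈toList⇒lookup v a∈v
      ... | p , vp≡a = F.zero , F.suc p , s≤s z≤n , refl , vp≡a
      go (x ∷ v) (later inv) with go v inv
      ... | q , p , q<p , vq≡b , vp≡a = F.suc q , F.suc p , s≤s q<p , vq≡b , vp≡a

    positions⇒Inverted : ∀ q p → toℕ q < toℕ p → Inverted (toList w) (lookup w p) (lookup w q)
    positions⇒Inverted = go w
      where
      go : ∀ {m} (v : Vec ℕ m) (q p : Fin m) → toℕ q < toℕ p → Inverted (toList v) (lookup v p) (lookup v q)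
      go (x ∷ v) F.zero (F.suc p) _ = now (lookup∈toList v p)
      go (x ∷ v) (F.suc q) (F.suc p) (s≤s q<p) = later (go v q p q<p)

    _≺_ : Fin n → Fin n → Set
    r ≺ p = lookup w r < lookup w p ⊎ (toℕ r < toℕ p × lookup w r ≡ lookup w p)

    _≺?_ : ∀ r p → Dec (r ≺ p)
    r ≺? p = (lookup w r <? lookup w p) ⊎-dec ((toℕ r <? toℕ p) ×-dec (lookup w r ≟ lookup w p))

    rank : Fin n → ℕ
    rank p = countFin n (_≺? p)

    std-rank : ∀ p → lookup (std w) p ≡ suc (rank p)
    std-rank p = trans (VP.lookup∘tabulate _ p)
      (cong suc (trans (cong₂ ℕ._+_ (count-allFin n _) (count-allFin n _))
        (sym (countFin-⊎ n _ _ (λ r lt eq → ℕP.<-irrefl (proj₂ eq) lt)))))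

    ≺-irrefl : ∀ p → ¬ p ≺ p
    ≺-irrefl p (inj₁ lt) = ℕP.<-irrefl refl lt
    ≺-irrefl p (inj₂ (lt , _)) = ℕP.<-irrefl refl lt

    ≺-trans : ∀ {r q p} → r ≺ q → q ≺ p → r ≺ p
    ≺-trans {r} (inj₁ lt) (inj₁ lt′) = inj₁ (ℕP.<-trans lt lt′)
    ≺-trans {r} (inj₁ lt) (inj₂ (_ , eq)) = inj₁ (subst (lookup w r <_) eq lt)
    ≺-trans {p = p} (inj₂ (_ , eq)) (inj₁ lt) = inj₁ (subst (_< lookup w p) (sym eq) lt)
    ≺-trans (inj₂ (lt , eq)) (inj₂ (lt′ , eq′)) = inj₂ (ℕP.<-trans lt lt′ , trans eq eq′)

    rank-mono : ∀ {q p} → q ≺ p → rank q < rank p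
    rank-mono {q} {p} q≺p = countFin-mono-< n (_≺? q) (_≺? p) (λ r r≺q → ≺-trans r≺q q≺p) q q≺p (≺-irrefl q)

    #≤ : ℕ → ℕ
    #≤ a = countFin n (λ r → lookup w r ≤? a)

    rank<#≤ : ∀ p → rank p < #≤ (lookup w p)
    rank<#≤ p = countFin-mono-< n (_≺? p) _ below p ℕP.≤-refl (≺-irrefl p)
      where
      below : ∀ r → r ≺ p → lookup w r ≤ lookup w p
      below r (inj₁ lt) = ℕP.<⇒≤ lt
      below r (inj₂ (_ , eq)) = ℕP.≤-reflexive eq

    #≤≤rank : ∀ {a} q → a < lookup w q → #≤ a ≤ rank q
    #≤≤rank q a<wq = countFin-mono n _ (_≺? q) (λ r wr≤a → inj₁ (ℕP.≤-<-trans wr≤a a<wq))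

    #≤-last : ∀ p → (∀ r → lookup w r ≡ lookup w p → toℕ r ≤ toℕ p) → #≤ (lookup w p) ≤ suc (rank p)
    #≤-last p last = begin
      #≤ (lookup w p)                                     ≤⟨ countFin-mono n _ (λ r → (r ≺? p) ⊎-dec (r F.≟ p)) split ⟩
      countFin n (λ r → (r ≺? p) ⊎-dec (r F.≟ p))        ≤⟨ countFin-⊎-≤ n (_≺? p) (F._≟ p) ⟩
      rank p ℕ.+ countFin n (F._≟ p)                      ≤⟨ ℕP.+-monoʳ-≤ (rank p) (countFin-≡-≤1 n p) ⟩
      rank p ℕ.+ 1                                        ≡⟨ ℕP.+-comm (rank p) 1 ⟩
      suc (rank p) ∎
      where
      open ℕP.≤-Reasoning
      split : ∀ r → lookup w r ≤ lookup w p → r ≺ p ⊎ r ≡ p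
      split r wr≤wp with ℕP.m≤n⇒m<n∨m≡n wr≤wp
      ... | inj₁ lt = inj₁ (inj₁ lt)
      ... | inj₂ eq with ℕP.m≤n⇒m<n∨m≡n (last r eq)
      ...   | inj₁ lt = inj₁ (inj₂ (lt , eq))
      ...   | inj₂ eq′ = inj₂ (FP.toℕ-injective eq′)

    rank≤#≤-first : ∀ {a} q → Adjacent (toList w) a (lookup w q) →
      (∀ r → lookup w r ≡ lookup w q → toℕ q ≤ toℕ r) → rank q ≤ #≤ a
    rank≤#≤-first {a} q adjacent first = countFin-mono n (_≺? q) _ below
      where
      below : ∀ r → r ≺ q → lookup w r ≤ a
      below r (inj₁ lt) with lookup w r ≤? a
      ... | yes le = le
      ... | no ¬le = ⊥-elim (ℕP.<⇒≱ lt (adjacent (lookup w r) (lookup∈toList w r) (ℕP.≰⇒> ¬le)))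
      below r (inj₂ (lt , eq)) = ⊥-elim (ℕP.<⇒≱ lt (first r eq))

    invDescent⇒adjacentInversion : ∀ i → InvDescent w i → AdjacentInversion (toList w) i
    invDescent⇒adjacentInversion i (p , q , std-p , std-q , q<p) =
      lookup w p , lookup w q , wp<wq , adjacent , i≡#≤ , positions⇒Inverted q p q<p
      where
      rank-q : rank q ≡ suc (rank p)
      rank-q = ℕP.suc-injective (trans (sym (std-rank q)) (trans std-q (cong suc (trans (sym std-p) (std-rank p)))))
      q⊀p : ¬ q ≺ p
      q⊀p q≺p = ℕP.<-asym (rank-mono q≺p) (subst (rank p <_) (sym rank-q) (ℕP.n<1+n (rank p)))
      gap : ∀ r → p ≺ r → ¬ r ≺ q
      gap r p≺r r≺q = ℕP.<⇒≱ (rank-mono p≺r) (ℕP.≤-pred (subst (rank r <_) rank-q (rank-mono r≺q)))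
      wp<wq : lookup w p < lookup w q
      wp<wq with ℕP.<-cmp (lookup w p) (lookup w q)
      ... | tri< lt _ _ = lt
      ... | tri≈ _ eq _ = ⊥-elim (q⊀p (inj₂ (q<p , sym eq)))
      ... | tri> _ _ gt = ⊥-elim (q⊀p (inj₁ gt))
      adjacent : Adjacent (toList w) (lookup w p) (lookup w q)
      adjacent x x∈w wp<x with ∈toList⇒lookup w x∈w
      ... | r , refl with lookup w q ≤? lookup w r
      ...   | yes le = le
      ...   | no ¬le = ⊥-elim (gap r (inj₁ wp<x) (inj₁ (ℕP.≰⇒> ¬le)))
      i≡#≤ : i ≡ countLe (lookup w p) (toList w)
      i≡#≤ = trans (trans (sym std-p) (std-rank p))
        (trans (ℕP.≤-antisym (rank<#≤ p) (subst (#≤ (lookup w p) ≤_) rank-q (#≤≤rank q wp<wq)))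
          (sym (countLe-toList (lookup w p))))

    adjacentInversion⇒invDescent : ∀ i → AdjacentInversion (toList w) i → InvDescent w i
    adjacentInversion⇒invDescent i (a , b , a<b , adjacent , i≡ , inv) with Inverted⇒positions inv
    ... | q₀ , p₀ , q₀<p₀ , wq₀≡b , wp₀≡a
      with lastOccurrence n (λ r → lookup w r ≟ a) p₀ wp₀≡a | firstOccurrence n (λ r → lookup w r ≟ b) q₀ wq₀≡b
    ... | p , refl , last | q , refl , first = p , q , std-p , std-q , q<p
      where
      #≤≡i : #≤ (lookup w p) ≡ i
      #≤≡i = sym (trans i≡ (countLe-toList (lookup w p)))
      std-p : lookup (std w) p ≡ i
      std-p = trans (std-rank p) (trans (ℕP.≤-antisym (rank<#≤ p) (#≤-last p last)) #≤≡i)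
      std-q : lookup (std w) q ≡ suc i
      std-q = trans (std-rank q) (cong suc (trans (ℕP.≤-antisym (rank≤#≤-first q adjacent first) (#≤≤rank q a<b)) #≤≡i))
      q<p : toℕ q < toℕ p
      q<p = ℕP.≤-<-trans (first q₀ wq₀≡b) (ℕP.<-≤-trans q₀<p₀ (last p₀ wp₀≡a))

module AdjacentInversions where

  open Standardization
  open import Data.Nat using (ℕ; _≤_; _<_)
  import Data.Nat.Properties as ℕP
  open import Data.Vec using (Vec; toList)
  open import Data.List using (List)
  open import Data.List.Membership.Propositional using (_∈_)
  open import Data.List.Relation.Binary.Permutation.Propositional using (_↭_; ↭-sym)
  open import Data.List.Relation.Binary.Permutation.Propositional.Properties using (∈-resp-↭; filter-↭; ↭-length)
  open import Data.Product using (_×_; _,_; proj₁; proj₂)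
  open import Data.Empty using (⊥-elim)
  open import Function using (_∘_)
  open import Function.Bundles using (_⇔_; mk⇔; Equivalence)
  open import Relation.Binary.Definitions using (tri<; tri≈; tri>)
  open import Relation.Binary.PropositionalEquality

  SameAdjacentInversions : List ℕ → List ℕ → Set
  SameAdjacentInversions l l′ = ∀ a b → a < b → Adjacent l a b → Inverted l a b ⇔ Inverted l′ a b

  module _ {l l′ : List ℕ} (l↭l′ : l ↭ l′) where

    countLe-↭ : ∀ a → countLe a l ≡ countLe a l′
    countLe-↭ a = ↭-length (filter-↭ (ℕP._≤? a) l↭l′)

    Adjacent-↭ : ∀ {a b} → Adjacent l a b → Adjacent l′ a b
    Adjacent-↭ adjacent x x∈l′ = adjacent x (∈-resp-↭ (↭-sym l↭l′) x∈l′)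

    adjacentInversion-↭ : (∀ a b → a < b → Adjacent l a b → Inverted l a b → Inverted l′ a b) →
      ∀ i → AdjacentInversion l i → AdjacentInversion l′ i
    adjacentInversion-↭ inverted i (a , b , a<b , adjacent , i≡ , inv) =
      a , b , a<b , Adjacent-↭ adjacent , trans i≡ (countLe-↭ a) , inverted a b a<b adjacent inv

    -- An adjacent inversion is recovered from its index i, since a is the letter
    -- with exactly i letters ≤ a and b is the next larger letter.
    adjacentInversion⇒inverted : (∀ i → AdjacentInversion l i → AdjacentInversion l′ i) →
      ∀ a b → a < b → Adjacent l a b → Inverted l a b → Inverted l′ a b
    adjacentInversion⇒inverted transfer a b a<b adjacent inv
      with transfer (countLe a l) (a , b , a<b , adjacent , refl , inv)
    ... | a′ , b′ , a′<b′ , adjacent′ , i≡ , inv′ = subst₂ (Inverted l′) (sym a≡a′) b′≡b inv′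
      where
      a∈l′ : a ∈ l′
      a∈l′ = ∈-resp-↭ l↭l′ (proj₁ (Inverted-∈ inv))
      b∈l′ : b ∈ l′
      b∈l′ = ∈-resp-↭ l↭l′ (proj₂ (Inverted-∈ inv))
      countLe-a≡a′ : countLe a l′ ≡ countLe a′ l′
      countLe-a≡a′ = trans (sym (countLe-↭ a)) i≡
      a≡a′ : a ≡ a′
      a≡a′ with ℕP.<-cmp a a′
      ... | tri< lt _ _ = ⊥-elim (ℕP.<-irrefl countLe-a≡a′ (countLe-mono-< lt (proj₁ (Inverted-∈ inv′))))
      ... | tri≈ _ eq _ = eq
      ... | tri> _ _ gt = ⊥-elim (ℕP.<-irrefl (sym countLe-a≡a′) (countLe-mono-< gt a∈l′))
      b′≡b : b′ ≡ b
      b′≡b = ℕP.≤-antisym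
        (adjacent′ b b∈l′ (subst (_< b) a≡a′ a<b))
        (adjacent b′ (∈-resp-↭ (↭-sym l↭l′) (proj₂ (Inverted-∈ inv′))) (subst (_< b′) (sym a≡a′) a′<b′))

  module _ {n} {w w′ : Vec ℕ n} where

    invDescents⇒adjacentInversions : (∀ i → InvDescent w i → InvDescent w′ i) →
      ∀ i → AdjacentInversion (toList w) i → AdjacentInversion (toList w′) i
    invDescents⇒adjacentInversions f i =
      invDescent⇒adjacentInversion w′ i ∘ f i ∘ adjacentInversion⇒invDescent w i

    adjacentInversions⇒invDescents : (∀ i → AdjacentInversion (toList w) i → AdjacentInversion (toList w′) i) →
      ∀ i → InvDescent w i → InvDescent w′ i
    adjacentInversions⇒invDescents f i =
      adjacentInversion⇒invDescent w′ i ∘ f i ∘ invDescent⇒adjacentInversion w i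

  hypo⇔ : ∀ {n} {w w′ : Vec ℕ n} →
    Hypo w w′ ⇔ (toList w ↭ toList w′ × SameAdjacentInversions (toList w) (toList w′))
  hypo⇔ {w = w} {w′} = mk⇔ to from
    where
    to : Hypo w w′ → toList w ↭ toList w′ × SameAdjacentInversions (toList w) (toList w′)
    to (w↭w′ , descents) = w↭w′ , λ a b a<b adjacent → mk⇔
      (adjacentInversion⇒inverted w↭w′
        (invDescents⇒adjacentInversions (Equivalence.to ∘ descents)) a b a<b adjacent)
      (adjacentInversion⇒inverted (↭-sym w↭w′)
        (invDescents⇒adjacentInversions (Equivalence.from ∘ descents)) a b a<b (Adjacent-↭ w↭w′ adjacent))
    from : toList w ↭ toList w′ × SameAdjacentInversions (toList w) (toList w′) → Hypo w w′
    from (w↭w′ , same) = w↭w′ , λ i → mk⇔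
      (adjacentInversions⇒invDescents (adjacentInversion-↭ w↭w′
        (λ a b a<b adjacent → Equivalence.to (same a b a<b adjacent))) i)
      (adjacentInversions⇒invDescents (adjacentInversion-↭ (↭-sym w↭w′)
        (λ a b a<b adjacent → Equivalence.from (same a b a<b (Adjacent-↭ (↭-sym w↭w′) adjacent)))) i)

module StepSequences where

  open Standardization using (Inverted; now; later; Inverted-∈; Adjacent; ∈toList⇒lookup)
  open import Data.Bool using (Bool; true; false)
  open import Data.Nat using (ℕ; suc; _≤_; _<_; z≤n; s≤s; _∸_; _+_)
  open import Data.Nat.Properties as ℕP using (_≟_)
  open import Data.Fin as F using (toℕ)
  import Data.Fin.Properties as FP
  open import Data.Vec using (Vec; []; _∷_; toList; lookup)
  open import Data.List as L using (List; _++_; [_])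
  import Data.List.Properties as LP
  open import Data.List.Membership.Propositional using (_∈_)
  open import Data.List.Membership.Propositional.Properties using (∈-++⁺ˡ; ∈-++⁺ʳ; ∈-++⁻)
  open import Data.List.Relation.Unary.Any using (here; there)
  open import Data.List.Relation.Unary.Linked using (Linked; [-]) renaming (_∷_ to _∷ˡ_)
  open import Data.List.Relation.Binary.Permutation.Propositional using (_↭_; ↭-sym; ↭-trans; ↭-reflexive)
  open import Data.List.Relation.Binary.Permutation.Propositional.Properties using (shift)
  open import Data.Product using (∃; _×_; _,_; proj₂)
  open import Data.Sum using (_⊎_; inj₁; inj₂; [_,_]′)
  open import Data.Empty using (⊥-elim)
  open import Relation.Nullary using (¬_; yes; no)
  open import Relation.Binary.PropositionalEquality hiding ([_])

  -- A sequence of steps describes the sorted letters of a word together with one bit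
  -- per pair of consecutive distinct letters: `stay` repeats the current letter v,
  -- `up e m` passes to v + 1 + e and records in m whether that pair is inverted.
  data Step : Set where
    stay : Step
    up   : ℕ → Bool → Step

  next : ℕ → Step → ℕ
  next v stay = v
  next v (up e _) = v + suc e

  climb : ∀ {k} → ℕ → Vec Step k → Vec ℕ k
  climb v [] = []
  climb v (t ∷ r) = next v t ∷ climb (next v t) r

  letters : ∀ {k} → ℕ → Vec Step k → Vec ℕ (suc k)
  letters v r = v ∷ climb v r

  -- d is the slack left in the parking condition aᵢ ≤ i.
  data Admissible : ∀ {k} → ℕ → Vec Step k → Set where
    end  : ∀ {d} → Admissible d []
    keep : ∀ {k d} {r : Vec Step k} → Admissible (suc d) r → Admissible d (stay ∷ r)
    rise : ∀ {k d e m} {r : Vec Step k} → e ≤ d → Admissible (d ∸ e) r → Admissible d (up e m ∷ r)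

  data Ascent : ∀ {k} → ℕ → Vec Step k → ℕ → ℕ → Bool → Set where
    start : ∀ {k v e m} {r : Vec Step k} → Ascent v (up e m ∷ r) v (v + suc e) m
    skip  : ∀ {k v t a b m} {r : Vec Step k} → Ascent (next v t) r a b m → Ascent v (t ∷ r) a b m

  Consecutive : List ℕ → ℕ → ℕ → Set
  Consecutive l a b = a < b × a ∈ l × b ∈ l × Adjacent l a b

  v<v+suc : ∀ v e → v < v + suc e
  v<v+suc v e = ℕP.m<m+n v (s≤s z≤n)

  v≤next : ∀ v t → v ≤ next v t
  v≤next v stay = ℕP.≤-refl
  v≤next v (up e _) = ℕP.<⇒≤ (v<v+suc v e)

  letters-≥ : ∀ {k} v (r : Vec Step k) {x} → x ∈ toList (letters v r) → v ≤ x
  letters-≥ v r (here refl) = ℕP.≤-refl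
  letters-≥ v (t ∷ r) (there x∈) = ℕP.≤-trans (v≤next v t) (letters-≥ (next v t) r x∈)

  letters-sorted : ∀ {k} v (r : Vec Step k) → Linked _≤_ (toList (letters v r))
  letters-sorted v [] = [-]
  letters-sorted v (t ∷ r) = v≤next v t ∷ˡ letters-sorted (next v t) r

  rise-slack : ∀ v {d e} → e ≤ d → v + suc e + (d ∸ e) ≡ suc (v + d)
  rise-slack v {d} {e} e≤d = begin
    v + suc e + (d ∸ e)   ≡⟨ ℕP.+-assoc v (suc e) (d ∸ e) ⟩
    v + suc (e + (d ∸ e)) ≡⟨ cong (λ x → v + suc x) (ℕP.m+[n∸m]≡n e≤d) ⟩
    v + suc d             ≡⟨ ℕP.+-suc v d ⟩
    suc (v + d) ∎
    where open ≡-Reasoning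

  letters-bound : ∀ {k d} v {r : Vec Step k} → Admissible d r → ∀ i → lookup (letters v r) i ≤ v + d + toℕ i
  letters-bound {d = d} v adm F.zero = ℕP.≤-trans (ℕP.m≤m+n v d) (ℕP.m≤m+n (v + d) 0)
  letters-bound {d = d} v (keep adm) (F.suc i) = begin
    lookup (letters v _) i  ≤⟨ letters-bound v adm i ⟩
    v + suc d + toℕ i       ≡⟨ cong (_+ toℕ i) (ℕP.+-suc v d) ⟩
    suc (v + d) + toℕ i     ≡⟨ ℕP.+-suc (v + d) (toℕ i) ⟨
    v + d + suc (toℕ i) ∎
    where open ℕP.≤-Reasoning
  letters-bound {d = d} v (rise {e = e} e≤d adm) (F.suc i) = begin
    lookup (letters (v + suc e) _) i ≤⟨ letters-bound (v + suc e) adm i ⟩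
    v + suc e + (d ∸ e) + toℕ i      ≡⟨ cong (_+ toℕ i) (rise-slack v e≤d) ⟩
    suc (v + d) + toℕ i              ≡⟨ ℕP.+-suc (v + d) (toℕ i) ⟨
    v + d + suc (toℕ i) ∎
    where open ℕP.≤-Reasoning

  letters-≤ : ∀ {k d} v {r : Vec Step k} → Admissible d r → ∀ {x} → x ∈ toList (letters v r) → x ≤ v + d + k
  letters-≤ {k} {d} v {r} adm x∈ with ∈toList⇒lookup (letters v r) x∈
  ... | i , refl = ℕP.≤-trans (letters-bound v adm i) (ℕP.+-monoʳ-≤ (v + d) (FP.toℕ≤pred[n] i))

  -- The word of a step sequence inserts its letters in increasing order, a new
  -- letter going to the front when its pair is inverted and to the back otherwise;
  -- repeated letters go to the same side as their first copy.
  side : Bool → Step → Bool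
  side s stay = s
  side _ (up _ m) = m

  insert : Bool → ℕ → List ℕ → List ℕ
  insert true x l = x L.∷ l
  insert false x l = l ++ [ x ]

  build : ∀ {k} → ℕ → Bool → List ℕ → Vec Step k → List ℕ
  build v s acc [] = acc
  build v s acc (t ∷ r) = build (next v t) (side s t) (insert (side s t) (next v t) acc) r

  wordOf : ∀ {k} → Vec Step k → List ℕ
  wordOf r = build 1 false [ 1 ] r

  insert-↭ : ∀ s x acc l → insert s x acc ++ l ↭ acc ++ x L.∷ l
  insert-↭ true x acc l = ↭-sym (shift x acc l)
  insert-↭ false x acc l = ↭-reflexive (LP.++-assoc acc [ x ] l)

  build-↭ : ∀ {k} v s acc (r : Vec Step k) → build v s acc r ↭ acc ++ toList (climb v r)
  build-↭ v s acc [] = ↭-reflexive (sym (LP.++-identityʳ acc))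
  build-↭ v s acc (t ∷ r) =
    ↭-trans (build-↭ (next v t) (side s t) _ r) (insert-↭ (side s t) (next v t) acc _)

  wordOf-↭ : ∀ {k} (r : Vec Step k) → wordOf r ↭ toList (letters 1 r)
  wordOf-↭ r = build-↭ 1 false [ 1 ] r

  ∈-insert : ∀ s x acc → x ∈ insert s x acc
  ∈-insert true x acc = here refl
  ∈-insert false x acc = ∈-++⁺ʳ acc (here refl)

  ∈-insert⁻ : ∀ {y} s x acc → y ∈ insert s x acc → y ∈ acc ⊎ y ≡ x
  ∈-insert⁻ true x acc (here eq) = inj₂ eq
  ∈-insert⁻ true x acc (there y∈) = inj₁ y∈
  ∈-insert⁻ false x acc y∈ with ∈-++⁻ acc y∈
  ... | inj₁ y∈acc = inj₁ y∈acc
  ... | inj₂ (here eq) = inj₂ eq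

  Inverted-++ʳ : ∀ {x a b} l → Inverted l a b → Inverted (l ++ [ x ]) a b
  Inverted-++ʳ (y L.∷ l) (now a∈l) = now (∈-++⁺ˡ a∈l)
  Inverted-++ʳ (y L.∷ l) (later inv) = later (Inverted-++ʳ l inv)

  Inverted-++ʳ⁻ : ∀ {x a b} l → Inverted (l ++ [ x ]) a b → Inverted l a b ⊎ (x ≡ a × b ∈ l)
  Inverted-++ʳ⁻ L.[] (now ())
  Inverted-++ʳ⁻ L.[] (later ())
  Inverted-++ʳ⁻ (y L.∷ l) (now a∈) with ∈-++⁻ l a∈
  ... | inj₁ a∈l = inj₁ (now a∈l)
  ... | inj₂ (here eq) = inj₂ (sym eq , here refl)
  Inverted-++ʳ⁻ (y L.∷ l) (later inv) with Inverted-++ʳ⁻ l inv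
  ... | inj₁ inv′ = inj₁ (later inv′)
  ... | inj₂ (eq , b∈l) = inj₂ (eq , there b∈l)

  Inverted-insert : ∀ {a b} s x acc → Inverted acc a b → Inverted (insert s x acc) a b
  Inverted-insert true x acc inv = later inv
  Inverted-insert false x acc inv = Inverted-++ʳ acc inv

  Inverted-build : ∀ {k a b} v s acc (r : Vec Step k) → Inverted acc a b → Inverted (build v s acc r) a b
  Inverted-build v s acc [] inv = inv
  Inverted-build v s acc (t ∷ r) inv =
    Inverted-build (next v t) (side s t) _ r (Inverted-insert (side s t) (next v t) acc inv)

  -- A new letter x creates an inversion (a, b) only if x = b goes to the front or
  -- x = a goes to the back.
  ¬Inverted-insert : ∀ {a b x} s acc → ¬ Inverted acc a b → a < x → s ≡ false ⊎ b < x →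
    ¬ Inverted (insert s x acc) a b
  ¬Inverted-insert true acc ¬inv a<x (inj₁ ())
  ¬Inverted-insert true acc ¬inv a<x (inj₂ b<x) (now _) = ℕP.<-irrefl refl b<x
  ¬Inverted-insert true acc ¬inv a<x (inj₂ b<x) (later inv) = ¬inv inv
  ¬Inverted-insert false acc ¬inv a<x _ inv with Inverted-++ʳ⁻ acc inv
  ... | inj₁ inv′ = ¬inv inv′
  ... | inj₂ (refl , _) = ℕP.<-irrefl refl a<x

  ¬Inverted-build : ∀ {k a b} v s acc (r : Vec Step k) → ¬ Inverted acc a b → a < b → b ≤ v →
    s ≡ false ⊎ b < v → ¬ Inverted (build v s acc r) a b
  ¬Inverted-build v s acc [] ¬inv a<b b≤v side-ok = ¬inv
  ¬Inverted-build {a = a} {b} v s acc (t ∷ r) ¬inv a<b b≤v side-ok =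
    ¬Inverted-build (next v t) (side s t) _ r
      (¬Inverted-insert (side s t) acc ¬inv (ℕP.<-≤-trans a<b b≤next) (side-ok′ t))
      a<b b≤next (side-ok′ t)
    where
    b≤next : b ≤ next v t
    b≤next = ℕP.≤-trans b≤v (v≤next v t)
    side-ok′ : ∀ t → side s t ≡ false ⊎ b < next v t
    side-ok′ stay = side-ok
    side-ok′ (up e _) = inj₂ (ℕP.≤-<-trans b≤v (v<v+suc v e))

  Top : ℕ → List ℕ → Set
  Top v acc = (∀ y → y ∈ acc → y ≤ v) × v ∈ acc

  Top-insert : ∀ {v acc} s t → Top v acc → Top (next v t) (insert s (next v t) acc)
  Top-insert {v} {acc} s t (≤v , _) =
    (λ y y∈ → [ (λ y∈acc → ℕP.≤-trans (≤v y y∈acc) (v≤next v t)) , ℕP.≤-reflexive ]′ (∈-insert⁻ s _ acc y∈))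
    , ∈-insert s _ acc

  ascent-true⇒Inverted : ∀ {k v a b} {r : Vec Step k} → Ascent v r a b true →
    ∀ s acc → Top v acc → Inverted (build v s acc r) a b
  ascent-true⇒Inverted {r = up e _ ∷ r} start s acc (_ , v∈acc) = Inverted-build _ true _ r (now v∈acc)
  ascent-true⇒Inverted {r = t ∷ _} (skip asc) s acc top =
    ascent-true⇒Inverted asc (side s t) _ (Top-insert (side s t) t top)

  ascent-false⇒¬Inverted : ∀ {k v a b} {r : Vec Step k} → Ascent v r a b false →
    ∀ s acc → Top v acc → ¬ Inverted (build v s acc r) a b
  ascent-false⇒¬Inverted {v = v} {r = up e _ ∷ r} start s acc (≤v , _) =
    ¬Inverted-build _ false _ r
      (¬Inverted-insert false acc ¬inv (v<v+suc v e) (inj₁ refl))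
      (v<v+suc v e) ℕP.≤-refl (inj₁ refl)
    where
    ¬inv : ¬ Inverted acc v (v + suc e)
    ¬inv inv = ℕP.<⇒≱ (v<v+suc v e) (≤v _ (proj₂ (Inverted-∈ inv)))
  ascent-false⇒¬Inverted {r = t ∷ _} (skip asc) s acc top =
    ascent-false⇒¬Inverted asc (side s t) _ (Top-insert (side s t) t top)

  Top-start : Top 1 [ 1 ]
  Top-start = (λ { y (here refl) → ℕP.≤-refl }) , here refl

  ascent⇒consecutive : ∀ {k v a b m} {r : Vec Step k} → Ascent v r a b m → Consecutive (toList (letters v r)) a b
  ascent⇒consecutive {v = v} {r = up e m ∷ r} start = v<v+suc v e , here refl , there (here refl) , adjacent
    where
    adjacent : Adjacent (toList (letters v (up e m ∷ r))) v (v + suc e)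
    adjacent x (here refl) v<v = ⊥-elim (ℕP.<-irrefl refl v<v)
    adjacent x (there x∈) _ = letters-≥ _ r x∈
  ascent⇒consecutive {v = v} {r = t ∷ r} (skip asc) with ascent⇒consecutive asc
  ... | a<b , a∈ , b∈ , adjacent = a<b , there a∈ , there b∈ , adjacent′
    where
    adjacent′ : Adjacent (toList (letters v (t ∷ r))) _ _
    adjacent′ x (here refl) a<v =
      ⊥-elim (ℕP.<⇒≱ a<v (ℕP.≤-trans (v≤next v t) (letters-≥ (next v t) r a∈)))
    adjacent′ x (there x∈) = adjacent x x∈

  consecutive⇒ascent : ∀ {k a b} v (r : Vec Step k) → Consecutive (toList (letters v r)) a b →
    ∃ λ m → Ascent v r a b m
  consecutive⇒ascent v r (a<b , here refl , here refl , _) = ⊥-elim (ℕP.<-irrefl refl a<b)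
  consecutive⇒ascent v (t ∷ r) (a<b , there a∈ , here refl , _) =
    ⊥-elim (ℕP.<⇒≱ a<b (ℕP.≤-trans (v≤next v t) (letters-≥ (next v t) r a∈)))
  consecutive⇒ascent v (t ∷ r) (a<b , there a∈ , there b∈ , adjacent) =
    let m , asc = consecutive⇒ascent (next v t) r (a<b , a∈ , b∈ , λ x x∈ → adjacent x (there x∈))
    in m , skip asc
  consecutive⇒ascent v (stay ∷ r) (a<b , here refl , there b∈ , adjacent) =
    let m , asc = consecutive⇒ascent v r (a<b , here refl , b∈ , λ x x∈ → adjacent x (there x∈))
    in m , skip asc
  consecutive⇒ascent v (up e m ∷ r) (a<b , here refl , there b∈ , adjacent) =
    m , subst (λ b → Ascent v (up e m ∷ r) v b m) next≡b start
    where
    next≡b : v + suc e ≡ _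
    next≡b = ℕP.≤-antisym (letters-≥ _ r b∈) (adjacent _ (there (here refl)) (v<v+suc v e))

  steps-injective : ∀ {k} v (r r′ : Vec Step k) → toList (letters v r) ≡ toList (letters v r′) →
    (∀ {a b m m′} → Ascent v r a b m → Ascent v r′ a b m′ → m ≡ m′) → r ≡ r′
  steps-injective v [] [] _ _ = refl
  steps-injective v (stay ∷ r) (stay ∷ r′) eq marks =
    cong (stay ∷_) (steps-injective v r r′ (LP.∷-injectiveʳ eq) (λ asc asc′ → marks (skip asc) (skip asc′)))
  steps-injective v (stay ∷ r) (up e _ ∷ r′) eq _ =
    ⊥-elim (ℕP.<⇒≢ (v<v+suc v e) (LP.∷-injectiveˡ (LP.∷-injectiveʳ eq)))
  steps-injective v (up e _ ∷ r) (stay ∷ r′) eq _ =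
    ⊥-elim (ℕP.<⇒≢ (v<v+suc v e) (sym (LP.∷-injectiveˡ (LP.∷-injectiveʳ eq))))
  steps-injective v (up e m ∷ r) (up e′ m′ ∷ r′) eq marks
    with ℕP.suc-injective (ℕP.+-cancelˡ-≡ v (suc e) (suc e′) (LP.∷-injectiveˡ (LP.∷-injectiveʳ eq)))
  ... | refl = cong₂ _∷_ (cong (up e) (marks start start))
    (steps-injective _ r r′ (LP.∷-injectiveʳ eq) (λ asc asc′ → marks (skip asc) (skip asc′)))

  gap-sum : ∀ {x y} → x < y → x + suc (y ∸ suc x) ≡ y
  gap-sum {x} {y} x<y = trans (ℕP.+-suc x (y ∸ suc x)) (ℕP.m+[n∸m]≡n x<y)

  stepBetween : (ℕ → ℕ → Bool) → ℕ → ℕ → Step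
  stepBetween mark x y with x ≟ y
  ... | yes _ = stay
  ... | no _ = up (y ∸ suc x) (mark x y)

  stepsFrom : ∀ {k} → (ℕ → ℕ → Bool) → ℕ → Vec ℕ k → Vec Step k
  stepsFrom mark x [] = []
  stepsFrom mark x (y ∷ ys) = stepBetween mark x y ∷ stepsFrom mark y ys

  climb-stepsFrom : ∀ {k} mark x (ys : Vec ℕ k) → Linked _≤_ (x L.∷ toList ys) →
    climb x (stepsFrom mark x ys) ≡ ys
  climb-stepsFrom mark x [] _ = refl
  climb-stepsFrom mark x (y ∷ ys) (x≤y ∷ˡ sorted) with x ≟ y
  ... | yes refl = cong (y ∷_) (climb-stepsFrom mark y ys sorted)
  ... | no x≢y rewrite gap-sum (ℕP.≤∧≢⇒< x≤y x≢y) = cong (y ∷_) (climb-stepsFrom mark y ys sorted)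

  stepsFrom-admissible : ∀ {k} mark d x (ys : Vec ℕ k) → Linked _≤_ (x L.∷ toList ys) →
    (∀ i → lookup (x ∷ ys) i ≤ x + d + toℕ i) → Admissible d (stepsFrom mark x ys)
  stepsFrom-admissible mark d x [] _ _ = end
  stepsFrom-admissible mark d x (y ∷ ys) (x≤y ∷ˡ sorted) bound with x ≟ y
  ... | yes refl = keep (stepsFrom-admissible mark (suc d) x ys sorted bound′)
    where
    bound′ : ∀ i → lookup (x ∷ ys) i ≤ x + suc d + toℕ i
    bound′ i = ℕP.≤-trans (bound (F.suc i)) (ℕP.≤-reflexive (begin
      x + d + suc (toℕ i) ≡⟨ ℕP.+-suc (x + d) (toℕ i) ⟩
      suc (x + d) + toℕ i ≡⟨ cong (_+ toℕ i) (ℕP.+-suc x d) ⟨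
      x + suc d + toℕ i ∎))
      where open ≡-Reasoning
  ... | no x≢y = rise e≤d (stepsFrom-admissible mark (d ∸ e) y ys sorted bound′)
    where
    e = y ∸ suc x
    x+suc-e≡y : x + suc e ≡ y
    x+suc-e≡y = gap-sum (ℕP.≤∧≢⇒< x≤y x≢y)
    e≤d : e ≤ d
    e≤d = ℕP.≤-pred (ℕP.+-cancelˡ-≤ x (suc e) (suc d) (begin
      x + suc e   ≡⟨ x+suc-e≡y ⟩
      y           ≤⟨ bound (F.suc F.zero) ⟩
      x + d + 1   ≡⟨ ℕP.+-assoc x d 1 ⟩
      x + (d + 1) ≡⟨ cong (x +_) (ℕP.+-comm d 1) ⟩
      x + suc d ∎))
      where open ℕP.≤-Reasoning
    bound′ : ∀ i → lookup (y ∷ ys) i ≤ y + (d ∸ e) + toℕ i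
    bound′ i = ℕP.≤-trans (bound (F.suc i)) (ℕP.≤-reflexive (begin
      x + d + suc (toℕ i)         ≡⟨ ℕP.+-suc (x + d) (toℕ i) ⟩
      suc (x + d) + toℕ i         ≡⟨ cong (_+ toℕ i) (rise-slack x e≤d) ⟨
      x + suc e + (d ∸ e) + toℕ i ≡⟨ cong (λ z → z + (d ∸ e) + toℕ i) x+suc-e≡y ⟩
      y + (d ∸ e) + toℕ i ∎))
      where open ≡-Reasoning

  stepsFrom-marks : ∀ {k} mark x (ys : Vec ℕ k) → Linked _≤_ (x L.∷ toList ys) →
    ∀ {a b m} → Ascent x (stepsFrom mark x ys) a b m → m ≡ mark a b
  stepsFrom-marks mark x (y ∷ ys) (x≤y ∷ˡ sorted) asc with x ≟ y
  stepsFrom-marks mark x (y ∷ ys) (x≤y ∷ˡ sorted) (skip asc) | yes refl = stepsFrom-marks mark x ys sorted asc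
  stepsFrom-marks mark x (y ∷ ys) (x≤y ∷ˡ sorted) start | no x≢y =
    cong (mark x) (sym (gap-sum (ℕP.≤∧≢⇒< x≤y x≢y)))
  stepsFrom-marks mark x (y ∷ ys) (x≤y ∷ˡ sorted) (skip asc) | no x≢y =
    stepsFrom-marks mark y ys sorted (subst (λ v → Ascent v (stepsFrom mark y ys) _ _ _) (gap-sum (ℕP.≤∧≢⇒< x≤y x≢y)) asc)

module Enumeration where

  open StepSequences
  open import Data.Bool using (Bool; true; false)
  open import Data.Nat using (ℕ; zero; suc; _+_; _≤_; z≤n; s≤s; _∸_)
  open import Data.Nat.Properties using (≤-irrelevant)
  open import Data.Fin using (Fin)
  open import Data.Fin.Properties using (+↔⊎)
  open import Data.Vec using (Vec; []; _∷_)
  open import Data.Product using (Σ; _×_; _,_; proj₁)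
  open import Data.Sum using (_⊎_; inj₁; inj₂)
  open import Data.Sum.Function.Propositional using (_⊎-↔_)
  open import Function.Bundles using (_↔_; mk↔ₛ′)
  open import Function.Properties.Inverse using (↔-trans; ↔-sym)
  open import Relation.Binary.PropositionalEquality

  mutual
    paths : ℕ → ℕ → ℕ
    paths 0 d = 1
    paths (suc k) d = paths k (suc d) + ascents k d

    ascents : ℕ → ℕ → ℕ
    ascents k 0 = paths k 0 + paths k 0
    ascents k (suc d) = ascents k d + (paths k (suc d) + paths k (suc d))

  AdmissibleSteps : ℕ → ℕ → Set
  AdmissibleSteps k d = Σ (Vec Step k) (Admissible d)

  AscentLed : ℕ → ℕ → Set
  AscentLed k d = Σ ℕ λ e → e ≤ d × Bool × AdmissibleSteps k (d ∸ e)

  AdmissibleSteps-suc-↔ : ∀ {k d} → AdmissibleSteps (suc k) d ↔ (AdmissibleSteps k (suc d) ⊎ AscentLed k d)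
  AdmissibleSteps-suc-↔ = mk↔ₛ′ to from to∘from from∘to
    where
    to : AdmissibleSteps (suc _) _ → AdmissibleSteps _ _ ⊎ AscentLed _ _
    to (stay ∷ r , keep adm) = inj₁ (r , adm)
    to (up e m ∷ r , rise e≤d adm) = inj₂ (e , e≤d , m , r , adm)
    from : AdmissibleSteps _ _ ⊎ AscentLed _ _ → AdmissibleSteps (suc _) _
    from (inj₁ (r , adm)) = stay ∷ r , keep adm
    from (inj₂ (e , e≤d , m , r , adm)) = up e m ∷ r , rise e≤d adm
    to∘from : ∀ x → to (from x) ≡ x
    to∘from (inj₁ _) = refl
    to∘from (inj₂ _) = refl
    from∘to : ∀ x → from (to x) ≡ x
    from∘to (stay ∷ _ , keep _) = refl
    from∘to (up _ _ ∷ _ , rise _ _) = refl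

  AscentLed-0-↔ : ∀ {k} → AscentLed k 0 ↔ (AdmissibleSteps k 0 ⊎ AdmissibleSteps k 0)
  AscentLed-0-↔ = mk↔ₛ′ to from to∘from from∘to
    where
    to : AscentLed _ 0 → AdmissibleSteps _ 0 ⊎ AdmissibleSteps _ 0
    to (0 , z≤n , false , s) = inj₁ s
    to (0 , z≤n , true , s) = inj₂ s
    from : AdmissibleSteps _ 0 ⊎ AdmissibleSteps _ 0 → AscentLed _ 0
    from (inj₁ s) = 0 , z≤n , false , s
    from (inj₂ s) = 0 , z≤n , true , s
    to∘from : ∀ x → to (from x) ≡ x
    to∘from (inj₁ _) = refl
    to∘from (inj₂ _) = refl
    from∘to : ∀ x → from (to x) ≡ x
    from∘to (0 , z≤n , false , _) = refl
    from∘to (0 , z≤n , true , _) = refl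

  AscentLed-suc-↔ : ∀ {k d} →
    AscentLed k (suc d) ↔ (AscentLed k d ⊎ (AdmissibleSteps k (suc d) ⊎ AdmissibleSteps k (suc d)))
  AscentLed-suc-↔ = mk↔ₛ′ to from to∘from from∘to
    where
    to : AscentLed _ (suc _) → AscentLed _ _ ⊎ (AdmissibleSteps _ _ ⊎ AdmissibleSteps _ _)
    to (suc e , s≤s e≤d , m , s) = inj₁ (e , e≤d , m , s)
    to (0 , z≤n , false , s) = inj₂ (inj₁ s)
    to (0 , z≤n , true , s) = inj₂ (inj₂ s)
    from : AscentLed _ _ ⊎ (AdmissibleSteps _ _ ⊎ AdmissibleSteps _ _) → AscentLed _ (suc _)
    from (inj₁ (e , e≤d , m , s)) = suc e , s≤s e≤d , m , s
    from (inj₂ (inj₁ s)) = 0 , z≤n , false , s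
    from (inj₂ (inj₂ s)) = 0 , z≤n , true , s
    to∘from : ∀ x → to (from x) ≡ x
    to∘from (inj₁ _) = refl
    to∘from (inj₂ (inj₁ _)) = refl
    to∘from (inj₂ (inj₂ _)) = refl
    from∘to : ∀ x → from (to x) ≡ x
    from∘to (suc _ , s≤s _ , _ , _) = refl
    from∘to (0 , z≤n , false , _) = refl
    from∘to (0 , z≤n , true , _) = refl

  mutual
    paths-↔ : ∀ k d → Fin (paths k d) ↔ AdmissibleSteps k d
    paths-↔ zero d = mk↔ₛ′ (λ _ → [] , end) (λ _ → Fin.zero) (λ { ([] , end) → refl }) (λ { Fin.zero → refl ; (Fin.suc ()) })
    paths-↔ (suc k) d = ↔-trans +↔⊎ (↔-trans (paths-↔ k (suc d) ⊎-↔ ascents-↔ k d) (↔-sym AdmissibleSteps-suc-↔))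

    ascents-↔ : ∀ k d → Fin (ascents k d) ↔ AscentLed k d
    ascents-↔ k zero = ↔-trans +↔⊎ (↔-trans (paths-↔ k 0 ⊎-↔ paths-↔ k 0) (↔-sym AscentLed-0-↔))
    ascents-↔ k (suc d) =
      ↔-trans +↔⊎ (↔-trans (ascents-↔ k d ⊎-↔ ↔-trans +↔⊎ (paths-↔ k (suc d) ⊎-↔ paths-↔ k (suc d)))
        (↔-sym AscentLed-suc-↔))

  Admissible-irrelevant : ∀ {k d} {r : Vec Step k} (p q : Admissible d r) → p ≡ q
  Admissible-irrelevant end end = refl
  Admissible-irrelevant (keep p) (keep q) = cong keep (Admissible-irrelevant p q)
  Admissible-irrelevant (rise e≤d p) (rise e≤d′ q) = cong₂ rise (≤-irrelevant e≤d e≤d′) (Admissible-irrelevant p q)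

  AdmissibleSteps-≡ : ∀ {k d} {s s′ : AdmissibleSteps k d} → proj₁ s ≡ proj₁ s′ → s ≡ s′
  AdmissibleSteps-≡ {s = r , p} {.r , q} refl = cong (r ,_) (Admissible-irrelevant p q)

module SchroederFormula where

  open Enumeration using (paths; ascents)
  open import Data.Nat as ℕ using (ℕ; zero; suc)
  import Data.Nat.Properties as ℕP
  open import Data.Integer using (ℤ; +_; _+_; _-_; _*_; -_; NonZero)
  import Data.Integer.Properties as ℤP
  open import Algebra.Properties.AbelianGroup ℤP.+-0-abelianGroup using (∙-cancelʳ)
  open import Data.Integer.Tactic.RingSolver using (solve-∀)
  open import Relation.Binary.PropositionalEquality
  open import Data.Nat.Combinatorics using (_C_; nCk+nC[k+1]≡[n+1]C[k+1]; nCn≡1; k>n⇒nCk≡0)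
  open import Data.List using (map; upTo; applyUpTo)
  open import Data.Nat.ListAction using (sum)
  open import Data.Nat.DivMod using (_/_; m*n/n≡m)
  import Data.Nat.Tactic.RingSolver as ℕSolver
  open import Algebra.Properties.CommutativeSemigroup ℕP.+-commutativeSemigroup using (interchange)

  -- The proofs below combine known equations L ≡ R with a ring identity
  -- lhs + R ≡ rhs + L checked by solve-∀.
  fromCombination : ∀ (lhs rhs L R : ℤ) → lhs + R ≡ rhs + L → L ≡ R → lhs ≡ rhs
  fromCombination lhs rhs L R identity L≡R =
    ∙-cancelʳ R lhs rhs (trans identity (cong (λ x → rhs + x) L≡R))

  fromScaledCombination : ∀ (k lhs rhs L R : ℤ) .{{_ : NonZero k}} →
    k * lhs + R ≡ k * rhs + L → L ≡ R → lhs ≡ rhs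
  fromScaledCombination k lhs rhs L R identity L≡R =
    ℤP.*-cancelˡ-≡ k lhs rhs (fromCombination (k * lhs) (k * rhs) L R identity L≡R)

  -- Φ m (2 + j) is the coefficient of x^j in φ(x)^m, where φ(x) = (1 + x)/(1 − x);
  -- the two leading zeros let the identities below hold uniformly in j.
  Φ : ℕ → ℕ → ℕ
  Φ m 0 = 0
  Φ m 1 = 0
  Φ m 2 = 1
  Φ 0 (suc (suc (suc j))) = 0
  Φ (suc m) (suc (suc (suc j))) =
    Φ (suc m) (suc (suc j)) ℕ.+ Φ m (suc (suc (suc j))) ℕ.+ Φ m (suc (suc j))

  Φℤ : ℕ → ℕ → ℤ
  Φℤ m j = + Φ m j

  -- (1 − x) φ^(m+1) = (1 + x) φ^m
  Φ-suc : ∀ m j → Φℤ (suc m) (suc j) ≡ Φℤ (suc m) j + Φℤ m (suc j) + Φℤ m j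
  Φ-suc m 0 = refl
  Φ-suc m 1 = refl
  Φ-suc m (suc (suc j)) = refl

  Φ-3 : ∀ m → Φℤ m 3 ≡ + 2 * + m
  Φ-3 m = trans (cong +_ (count m)) (ℤP.pos-* 2 m)
    where
    count : ∀ m → Φ m 3 ≡ 2 ℕ.* m
    count zero = refl
    count (suc m) rewrite count m =
      cong suc (trans (ℕP.+-comm (2 ℕ.* m) 1) (sym (ℕP.+-suc m (m ℕ.+ 0))))

  -- Coefficientwise form of (1 − x²) (φ^m)′ = 2m φ^m.
  Φ-ode : ∀ m j → + j * Φℤ m (2 ℕ.+ j) ≡ + 2 * + m * Φℤ m (1 ℕ.+ j) + (+ j - + 2) * Φℤ m j
  Φ-ode m 0 = identity (+ m) (Φℤ m 2)
    where
    identity : ∀ (x y : ℤ) → + 0 * y ≡ + 2 * x * + 0 + (+ 0 - + 2) * + 0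
    identity = solve-∀
  Φ-ode m 1 = trans (cong (+ 1 *_) (Φ-3 m)) (identity (+ m))
    where
    identity : ∀ (x : ℤ) → + 1 * (+ 2 * x) ≡ + 2 * x * + 1 + (+ 1 - + 2) * + 0
    identity = solve-∀
  Φ-ode zero 2 = refl
  Φ-ode zero (suc (suc (suc j))) = identity (+ (3 ℕ.+ j))
    where
    identity : ∀ (j : ℤ) → j * + 0 ≡ + 2 * + 0 * + 0 + (j - + 2) * + 0
    identity = solve-∀
  Φ-ode (suc m) (suc (suc j)) =
    fromCombination _ _ _ _
      (identity (+ m) (+ j) (A 1) (A 2) (A 3) (A 4) (B 1) (B 2) (B 3) (B 4))
      (cong₂ _+_ (cong₂ _+_ (cong₂ _+_ (cong₂ _+_ (cong₂ _+_
        (Φ-ode (suc m) (suc j)) (Φ-ode m (2 ℕ.+ j))) (Φ-ode m (1 ℕ.+ j)))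
        (cong ((+ 2 + + j) *_) (Φ-suc m (3 ℕ.+ j))))
        (cong ((+ 1 - + 2 * (+ 1 + + m)) *_) (Φ-suc m (2 ℕ.+ j))))
        (cong ((+ 1 - + j) *_) (Φ-suc m (1 ℕ.+ j))))
    where
    A B : ℕ → ℤ
    A i = Φℤ (suc m) (i ℕ.+ j)
    B i = Φℤ m (i ℕ.+ j)
    identity : ∀ (m j A1 A2 A3 A4 B1 B2 B3 B4 : ℤ) →
      (+ 2 + j) * A4
      + ( (+ 2 * (+ 1 + m) * A2 + ((+ 1 + j) - + 2) * A1)
        + (+ 2 * m * B3 + ((+ 2 + j) - + 2) * B2)
        + (+ 2 * m * B2 + ((+ 1 + j) - + 2) * B1)
        + (+ 2 + j) * (A3 + B4 + B3)
        + (+ 1 - + 2 * (+ 1 + m)) * (A2 + B3 + B2)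
        + (+ 1 - j) * (A1 + B2 + B1))
      ≡ (+ 2 * (+ 1 + m) * A3 + ((+ 2 + j) - + 2) * A2)
      + ( (+ 1 + j) * A3
        + (+ 2 + j) * B4
        + (+ 1 + j) * B3
        + (+ 2 + j) * A4
        + (+ 1 - + 2 * (+ 1 + m)) * A3
        + (+ 1 - j) * A2)
    identity = solve-∀

  Φ-lower : ∀ p q → + (suc p) * Φℤ p (3 ℕ.+ q) ≡
    (+ (suc p) - + (suc q)) * Φℤ (suc p) (3 ℕ.+ q) + (+ (suc q) - + 1) * Φℤ (suc p) (2 ℕ.+ q)
  Φ-lower p q =
    fromScaledCombination (+ 2) _ _ _ _
      (identity (+ p) (+ q) (A 1) (A 2) (A 3) (B 1) (B 2) (B 3))
      (cong₂ _+_ (cong₂ _+_ (cong₂ _+_ (Φ-ode (suc p) (suc q)) (Φ-ode p (suc q)))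
        (cong (((+ 1 + + q) - + 2 * (+ 1 + + p)) *_) (Φ-suc p (2 ℕ.+ q))))
        (cong ((+ 2 - (+ 1 + + q)) *_) (Φ-suc p (1 ℕ.+ q))))
    where
    A B : ℕ → ℤ
    A i = Φℤ (suc p) (i ℕ.+ q)
    B i = Φℤ p (i ℕ.+ q)
    identity : ∀ (p q A1 A2 A3 B1 B2 B3 : ℤ) →
      + 2 * ((+ 1 + p) * B3)
      + ( (+ 2 * (+ 1 + p) * A2 + ((+ 1 + q) - + 2) * A1)
        + (+ 2 * p * B2 + ((+ 1 + q) - + 2) * B1)
        + ((+ 1 + q) - + 2 * (+ 1 + p)) * (A2 + B3 + B2)
        + (+ 2 - (+ 1 + q)) * (A1 + B2 + B1))
      ≡ + 2 * (((+ 1 + p) - (+ 1 + q)) * A3 + ((+ 1 + q) - + 1) * A2)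
      + ( (+ 1 + q) * A3
        + (+ 1 + q) * B3
        + ((+ 1 + q) - + 2 * (+ 1 + p)) * A3
        + (+ 2 - (+ 1 + q)) * A2)
    identity = solve-∀

  -- T m j is the coefficient of t^(m + j) in τ(t)^m, where τ = t φ(τ); the recursion
  -- is τ^(m+1) (1 − τ) = t τ^m (1 + τ).
  T : ℕ → ℕ → ℕ
  T m 0 = 1
  T 0 (suc j) = 0
  T (suc m) (suc j) = T (suc (suc m)) j ℕ.+ T m (suc j) ℕ.+ T (suc m) j

  Tℤ : ℕ → ℕ → ℤ
  Tℤ m j = + T m j

  Lagrange : ℕ → ℕ → Set
  Lagrange m j = + (m ℕ.+ j) * Tℤ m j ≡ + m * Φℤ (m ℕ.+ j) (2 ℕ.+ j)

  lagrange-step : ∀ m j → Lagrange (suc (suc m)) j → Lagrange m (suc j) → Lagrange (suc m) j →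
    Lagrange (suc m) (suc j)
  lagrange-step m j IH₁ IH₂ IH₃ =
    subst (λ t → + (suc t) * Tℤ (suc m) (suc j) ≡ + (suc m) * Φℤ (suc t) (3 ℕ.+ j))
      (sym (ℕP.+-suc m j)) main
    where
    IH₂′ : + (suc (m ℕ.+ j)) * Tℤ m (suc j) ≡ + m * Φℤ (suc (m ℕ.+ j)) (3 ℕ.+ j)
    IH₂′ = subst (λ t → + t * Tℤ m (suc j) ≡ + m * Φℤ t (3 ℕ.+ j)) (ℕP.+-suc m j) IH₂
    s : ℕ
    s = m ℕ.+ j
    main : + (suc (suc s)) * Tℤ (suc m) (suc j) ≡ + (suc m) * Φℤ (suc (suc s)) (3 ℕ.+ j)
    main = fromScaledCombination (+ (suc s)) _ _ _ _
      (identity (+ m) (+ j) (Tℤ (2 ℕ.+ m) j) (Tℤ m (suc j)) (Tℤ (suc m) j)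
        (Φℤ (2 ℕ.+ s) (2 ℕ.+ j)) (Φℤ (2 ℕ.+ s) (3 ℕ.+ j))
        (Φℤ (1 ℕ.+ s) (2 ℕ.+ j)) (Φℤ (1 ℕ.+ s) (3 ℕ.+ j)))
      (cong₂ _+_ (cong₂ _+_ (cong₂ _+_ (cong₂ _+_
        (cong ((+ 1 + (+ m + + j)) *_) IH₁)
        (cong ((+ 2 + (+ m + + j)) *_) IH₂′))
        (cong ((+ 2 + (+ m + + j)) *_) IH₃))
        (cong ((- ((+ 1 + + m) * (+ 2 + (+ m + + j)))) *_) (Φ-suc (suc s) (2 ℕ.+ j))))
        (cong ((- + 1) *_) (Φ-lower (suc s) j)))
      where
      identity : ∀ (m j A B C P1 P2 Q1 Q2 : ℤ) →
        (+ 1 + (m + j)) * ((+ 2 + (m + j)) * (A + B + C))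
        + ( (+ 1 + (m + j)) * ((+ 2 + m) * P1)
          + (+ 2 + (m + j)) * (m * Q2)
          + (+ 2 + (m + j)) * ((+ 1 + m) * Q1)
          + (- ((+ 1 + m) * (+ 2 + (m + j)))) * (P1 + Q2 + Q1)
          + (- + 1) * (((+ 2 + (m + j)) - (+ 1 + j)) * P2 + ((+ 1 + j) - + 1) * P1))
        ≡ (+ 1 + (m + j)) * ((+ 1 + m) * P2)
        + ( (+ 1 + (m + j)) * ((+ 2 + (m + j)) * A)
          + (+ 2 + (m + j)) * ((+ 1 + (m + j)) * B)
          + (+ 2 + (m + j)) * ((+ 1 + (m + j)) * C)
          + (- ((+ 1 + m) * (+ 2 + (m + j)))) * P2
          + (- + 1) * ((+ 2 + (m + j)) * Q2))
      identity = solve-∀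

  lagrange : ∀ m j → Lagrange m j
  lagrange m zero rewrite ℕP.+-identityʳ m = refl
  lagrange zero (suc j) = identity (+ suc j) (Φℤ (suc j) (3 ℕ.+ j))
    where
    identity : ∀ (x y : ℤ) → x * + 0 ≡ + 0 * y
    identity = solve-∀
  lagrange (suc m) (suc j) =
    lagrange-step m j (lagrange (suc (suc m)) j) (lagrange m (suc j)) (lagrange (suc m) j)

  PathsFormula : ℕ → ℕ → Set
  PathsFormula k d = + (paths k d ℕ.+ paths k d) ≡ Tℤ (suc d) k + Tℤ (2 ℕ.+ d) k

  ascents-T : ∀ k d → (∀ e → PathsFormula k e) →
    + (ascents k d ℕ.+ ascents k d) + Tℤ (2 ℕ.+ d) k + Tℤ (3 ℕ.+ d) k ≡ Tℤ (suc d) (suc k) + Tℤ (2 ℕ.+ d) (suc k)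
  ascents-T k zero twice =
    fromCombination _ _ _ _ (identity (+ (paths k 0 ℕ.+ paths k 0)) (Tℤ 1 k) (Tℤ 2 k) (Tℤ 3 k))
      (cong₂ _+_ (twice 0) (twice 0))
    where
    identity : ∀ (X F1 F2 F3 : ℤ) →
      (X + X) + F2 + F3 + ((F1 + F2) + (F1 + F2))
      ≡ ((F2 + + 0 + F1) + (F3 + (F2 + + 0 + F1) + F2)) + (X + X)
    identity = solve-∀
  ascents-T k (suc d) twice =
    fromCombination _ _ _ _
      (identity (+ ascents k d) (+ (paths k (suc d) ℕ.+ paths k (suc d)))
        (Tℤ (2 ℕ.+ d) k) (Tℤ (3 ℕ.+ d) k) (Tℤ (4 ℕ.+ d) k) (Tℤ (suc d) (suc k)))
      (cong₂ _+_ (ascents-T k d twice) (cong₂ _+_ (twice (suc d)) (twice (suc d))))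
    where
    identity : ∀ (U Y F2 F3 F4 G1 : ℤ) →
      (U + Y) + (U + Y) + F3 + F4 + (G1 + (F3 + G1 + F2) + ((F2 + F3) + (F2 + F3)))
      ≡ (F3 + G1 + F2) + (F4 + (F3 + G1 + F2) + F3) + ((U + U + F2 + F3) + (Y + Y))
    identity = solve-∀

  paths-T : ∀ k d → PathsFormula k d
  paths-T zero d = refl
  paths-T (suc k) d =
    fromCombination _ _ _ _
      (identity (+ paths k (suc d)) (+ ascents k d) (Tℤ (2 ℕ.+ d) k) (Tℤ (3 ℕ.+ d) k)
        (Tℤ (suc d) (suc k)) (Tℤ (2 ℕ.+ d) (suc k)))
      (cong₂ _+_ (paths-T k (suc d)) (ascents-T k d (paths-T k)))
    where
    identity : ∀ (N U F2 F3 G1 G2 : ℤ) →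
      (N + U) + (N + U) + ((F2 + F3) + (G1 + G2))
      ≡ (G1 + G2) + ((N + N) + (U + U + F2 + F3))
    identity = solve-∀

  T-1 : ∀ k → T 1 (suc k) ≡ T 1 k ℕ.+ T 2 k
  T-1 k = trans (cong (ℕ._+ T 1 k) (ℕP.+-identityʳ (T 2 k))) (ℕP.+-comm (T 2 k) (T 1 k))

  Φ-paths : ∀ k → Φ (2 ℕ.+ k) (3 ℕ.+ k) ≡ (2 ℕ.+ k) ℕ.* (paths k 0 ℕ.+ paths k 0)
  Φ-paths k = ℤP.+-injective (begin
    Φℤ (2 ℕ.+ k) (3 ℕ.+ k)        ≡⟨ sym (ℤP.*-identityˡ _) ⟩
    + 1 * Φℤ (2 ℕ.+ k) (3 ℕ.+ k)  ≡⟨ sym (lagrange 1 (suc k)) ⟩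
    + (2 ℕ.+ k) * Tℤ 1 (suc k)    ≡⟨ cong (λ t → + (2 ℕ.+ k) * + t) (T-1 k) ⟩
    + (2 ℕ.+ k) * (Tℤ 1 k + Tℤ 2 k) ≡⟨ cong (+ (2 ℕ.+ k) *_) (sym (paths-T k 0)) ⟩
    + (2 ℕ.+ k) * + (paths k 0 ℕ.+ paths k 0) ≡⟨ sym (ℤP.pos-* (2 ℕ.+ k) (paths k 0 ℕ.+ paths k 0)) ⟩
    + ((2 ℕ.+ k) ℕ.* (paths k 0 ℕ.+ paths k 0)) ∎)
    where open ≡-Reasoning

  antidiagonalSum : ℕ → (ℕ → ℕ → ℕ) → ℕ
  antidiagonalSum 0 f = f 0 0
  antidiagonalSum (suc j) f = f 0 (suc j) ℕ.+ antidiagonalSum j (λ a b → f (suc a) b)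

  antidiagonalSum-suc : ∀ j f →
    antidiagonalSum (suc j) f ≡ antidiagonalSum j (λ a b → f a (suc b)) ℕ.+ f (suc j) 0
  antidiagonalSum-suc zero f = refl
  antidiagonalSum-suc (suc j) f =
    trans (cong (f 0 (suc (suc j)) ℕ.+_) (antidiagonalSum-suc j (λ a b → f (suc a) b)))
      (sym (ℕP.+-assoc (f 0 (suc (suc j))) _ _))

  antidiagonalSum-+ : ∀ j f g →
    antidiagonalSum j (λ a b → f a b ℕ.+ g a b) ≡ antidiagonalSum j f ℕ.+ antidiagonalSum j g
  antidiagonalSum-+ zero f g = refl
  antidiagonalSum-+ (suc j) f g =
    trans (cong (f 0 (suc j) ℕ.+ g 0 (suc j) ℕ.+_) (antidiagonalSum-+ j (λ a b → f (suc a) b) (λ a b → g (suc a) b)))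
      (interchange (f 0 (suc j)) (g 0 (suc j)) _ _)

  antidiagonalSum-cong : ∀ j f g → (∀ a b → a ℕ.+ b ≡ j → f a b ≡ g a b) →
    antidiagonalSum j f ≡ antidiagonalSum j g
  antidiagonalSum-cong zero f g f≗g = f≗g 0 0 refl
  antidiagonalSum-cong (suc j) f g f≗g =
    cong₂ ℕ._+_ (f≗g 0 (suc j) refl) (antidiagonalSum-cong j _ _ (λ a b e → f≗g (suc a) b (cong suc e)))

  antidiagonalSum-zero : ∀ j f → (∀ a b → f a b ≡ 0) → antidiagonalSum j f ≡ 0
  antidiagonalSum-zero zero f f≗0 = f≗0 0 0
  antidiagonalSum-zero (suc j) f f≗0 =
    cong₂ ℕ._+_ (f≗0 0 (suc j)) (antidiagonalSum-zero j _ (λ a b → f≗0 (suc a) b))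

  sum-applyUpTo : ∀ (f g : ℕ → ℕ) j → sum (map f (applyUpTo g (suc j))) ≡ antidiagonalSum j (λ a b → f (g a))
  sum-applyUpTo f g zero = ℕP.+-identityʳ _
  sum-applyUpTo f g (suc j) = cong (f (g 0) ℕ.+_) (sum-applyUpTo f (λ x → g (suc x)) j)

  -- [x^j] (1 + x)^(m+1) (1 − x)^(−(m+1))
  binomialProduct : ℕ → ℕ → ℕ
  binomialProduct m j = antidiagonalSum j (λ a b → (suc m C a) ℕ.* ((m ℕ.+ b) C b))

  pascal : ∀ n k → suc n C suc k ≡ n C k ℕ.+ n C suc k
  pascal n k = sym (nCk+nC[k+1]≡[n+1]C[k+1] n k)

  pascal-+ : ∀ m b → (suc m ℕ.+ suc b) C suc b ≡ (suc m ℕ.+ b) C b ℕ.+ (m ℕ.+ suc b) C suc b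
  pascal-+ m b = begin
    (suc m ℕ.+ suc b) C suc b             ≡⟨ cong (λ t → suc t C suc b) (ℕP.+-suc m b) ⟩
    suc (suc (m ℕ.+ b)) C suc b           ≡⟨ pascal (suc (m ℕ.+ b)) b ⟩
    suc (m ℕ.+ b) C b ℕ.+ suc (m ℕ.+ b) C suc b ≡⟨ cong (λ t → suc (m ℕ.+ b) C b ℕ.+ t C suc b) (sym (ℕP.+-suc m b)) ⟩
    (suc m ℕ.+ b) C b ℕ.+ (m ℕ.+ suc b) C suc b ∎
    where open ≡-Reasoning

  binomialProduct-0 : ∀ j → binomialProduct 0 (suc j) ≡ 2
  binomialProduct-0 j =
    cong₂ ℕ._+_ (trans (ℕP.+-identityʳ _) (nCn≡1 (suc j))) (tail j)
    where
    tail : ∀ j → antidiagonalSum j (λ a b → (1 C suc a) ℕ.* (b C b)) ≡ 1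
    tail zero = refl
    tail (suc j) = cong₂ ℕ._+_ (trans (ℕP.+-identityʳ _) (nCn≡1 (suc j)))
      (antidiagonalSum-zero j _ (λ a b → cong (ℕ._* (b C b)) (k>n⇒nCk≡0 {1} {suc (suc a)} (ℕ.s≤s (ℕ.s≤s ℕ.z≤n)))))

  binomialProduct-suc : ∀ m j → binomialProduct (suc m) (suc j) ≡
    binomialProduct (suc m) j ℕ.+ binomialProduct m (suc j) ℕ.+ binomialProduct m j
  binomialProduct-suc m j = begin
    binomialProduct (suc m) (suc j)
      ≡⟨ antidiagonalSum-suc j (λ a b → A a ℕ.* ((suc m ℕ.+ b) C b)) ⟩
    antidiagonalSum j (λ a b → A a ℕ.* ((suc m ℕ.+ suc b) C suc b)) ℕ.+ A (suc j) ℕ.* 1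
      ≡⟨ cong (ℕ._+ A (suc j) ℕ.* 1) (trans (antidiagonalSum-cong j _ _ (λ a b _ →
           trans (cong (A a ℕ.*_) (pascal-+ m b)) (ℕP.*-distribˡ-+ (A a) _ _))) (antidiagonalSum-+ j _ _)) ⟩
    (binomialProduct (suc m) j ℕ.+ antidiagonalSum j (λ a b → A a ℕ.* ((m ℕ.+ suc b) C suc b))) ℕ.+ A (suc j) ℕ.* 1
      ≡⟨ ℕP.+-assoc (binomialProduct (suc m) j) _ _ ⟩
    binomialProduct (suc m) j ℕ.+ (antidiagonalSum j (λ a b → A a ℕ.* ((m ℕ.+ suc b) C suc b)) ℕ.+ A (suc j) ℕ.* ((m ℕ.+ 0) C 0))
      ≡⟨ cong (binomialProduct (suc m) j ℕ.+_) (sym (antidiagonalSum-suc j (λ a b → A a ℕ.* ((m ℕ.+ b) C b)))) ⟩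
    binomialProduct (suc m) j ℕ.+ antidiagonalSum (suc j) (λ a b → A a ℕ.* ((m ℕ.+ b) C b))
      ≡⟨ cong (binomialProduct (suc m) j ℕ.+_) lower ⟩
    binomialProduct (suc m) j ℕ.+ (binomialProduct m (suc j) ℕ.+ binomialProduct m j)
      ≡⟨ sym (ℕP.+-assoc (binomialProduct (suc m) j) _ _) ⟩
    binomialProduct (suc m) j ℕ.+ binomialProduct m (suc j) ℕ.+ binomialProduct m j ∎
    where
    open ≡-Reasoning
    A : ℕ → ℕ
    A a = suc (suc m) C a
    lower : antidiagonalSum (suc j) (λ a b → A a ℕ.* ((m ℕ.+ b) C b)) ≡ binomialProduct m (suc j) ℕ.+ binomialProduct m j
    lower = begin
      A 0 ℕ.* ((m ℕ.+ suc j) C suc j) ℕ.+ antidiagonalSum j (λ a b → A (suc a) ℕ.* ((m ℕ.+ b) C b))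
        ≡⟨ cong (((m ℕ.+ suc j) C suc j) ℕ.+ 0 ℕ.+_) (trans (antidiagonalSum-cong j _ _ (λ a b _ →
             trans (cong (ℕ._* ((m ℕ.+ b) C b)) (pascal (suc m) a)) (ℕP.*-distribʳ-+ ((m ℕ.+ b) C b) (suc m C a) _)))
             (antidiagonalSum-+ j _ _)) ⟩
      ((m ℕ.+ suc j) C suc j) ℕ.+ 0 ℕ.+ (binomialProduct m j ℕ.+ antidiagonalSum j (λ a b → (suc m C suc a) ℕ.* ((m ℕ.+ b) C b)))
        ≡⟨ swap (((m ℕ.+ suc j) C suc j) ℕ.+ 0) (binomialProduct m j) _ ⟩
      binomialProduct m (suc j) ℕ.+ binomialProduct m j ∎
      where
      swap : ∀ a b c → a ℕ.+ (b ℕ.+ c) ≡ (a ℕ.+ c) ℕ.+ b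
      swap = ℕSolver.solve-∀

  binomialProduct-Φ : ∀ m j → binomialProduct m j ≡ Φ (suc m) (2 ℕ.+ j)
  binomialProduct-Φ m zero = refl
  binomialProduct-Φ zero (suc j) = trans (binomialProduct-0 j) (sym (Φ-1 j))
    where
    Φ-1 : ∀ j → Φ 1 (3 ℕ.+ j) ≡ 2
    Φ-1 zero = refl
    Φ-1 (suc j) = trans (ℕP.+-identityʳ _) (trans (ℕP.+-identityʳ _) (Φ-1 j))
  binomialProduct-Φ (suc m) (suc j) =
    trans (binomialProduct-suc m j)
      (cong₂ ℕ._+_ (cong₂ ℕ._+_ (binomialProduct-Φ (suc m) j) (binomialProduct-Φ m (suc j))) (binomialProduct-Φ m j))

  schroederSum-binomialProduct : ∀ n →
    sum (map (λ k → ((suc n) C k) ℕ.* (((n ℕ.+ n) ℕ.∸ k) C (n ℕ.∸ k))) (upTo (suc n))) ≡ binomialProduct n n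
  schroederSum-binomialProduct n =
    trans (sum-applyUpTo _ (λ x → x) n) (antidiagonalSum-cong n _ _ λ a b e → cong ((suc n C a) ℕ.*_) (reindex a b e))
    where
    reindex : ∀ a b → a ℕ.+ b ≡ n → ((n ℕ.+ n) ℕ.∸ a) C (n ℕ.∸ a) ≡ (n ℕ.+ b) C b
    reindex a b refl = cong₂ _C_ arithmetic (ℕP.m+n∸m≡n a b)
      where
      arithmetic : (a ℕ.+ b ℕ.+ (a ℕ.+ b)) ℕ.∸ a ≡ a ℕ.+ b ℕ.+ b
      arithmetic = begin
        (a ℕ.+ b ℕ.+ (a ℕ.+ b)) ℕ.∸ a ≡⟨ cong (ℕ._∸ a) (ℕP.+-assoc a b (a ℕ.+ b)) ⟩
        (a ℕ.+ (b ℕ.+ (a ℕ.+ b))) ℕ.∸ a ≡⟨ ℕP.m+n∸m≡n a (b ℕ.+ (a ℕ.+ b)) ⟩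
        b ℕ.+ (a ℕ.+ b)                ≡⟨ ℕP.+-comm b (a ℕ.+ b) ⟩
        a ℕ.+ b ℕ.+ b ∎
        where open ≡-Reasoning

  schroeder-paths : ∀ k → schroeder (suc k) ≡ paths k 0
  schroeder-paths k = begin
    schroeder (suc k)                                    ≡⟨ cong (_/ 2+2n) numerator ⟩
    paths k 0 ℕ.* 2+2n / 2+2n                            ≡⟨ m*n/n≡m (paths k 0) 2+2n ⟩
    paths k 0 ∎
    where
    open ≡-Reasoning
    2+2n : ℕ
    2+2n = suc (suc (suc k ℕ.+ suc k))
    numerator : sum (map (λ i → (suc (suc k) C i) ℕ.* (((suc k ℕ.+ suc k) ℕ.∸ i) C (suc k ℕ.∸ i))) (upTo (suc (suc k))))
                ≡ paths k 0 ℕ.* 2+2n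
    numerator = begin
      _                                         ≡⟨ schroederSum-binomialProduct (suc k) ⟩
      binomialProduct (suc k) (suc k)           ≡⟨ binomialProduct-Φ (suc k) (suc k) ⟩
      Φ (2 ℕ.+ k) (3 ℕ.+ k)                     ≡⟨ Φ-paths k ⟩
      (2 ℕ.+ k) ℕ.* (paths k 0 ℕ.+ paths k 0)  ≡⟨ arithmetic k (paths k 0) ⟩
      paths k 0 ℕ.* 2+2n ∎
      where
      arithmetic : ∀ k x → (2 ℕ.+ k) ℕ.* (x ℕ.+ x) ≡ x ℕ.* suc (suc (suc k ℕ.+ suc k))
      arithmetic = ℕSolver.solve-∀

module Representatives where

  open Standardization using (Inverted; now; later; Inverted-∈; Adjacent; lookup∈toList; ∈toList⇒lookup)
  open AdjacentInversions using (hypo⇔; SameAdjacentInversions)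
  open StepSequences
  open import Data.Bool using (Bool; true; false)
  open import Data.Nat using (ℕ; suc; _≤_; _<_; z≤n; s≤s)
  open import Data.Nat.Properties as ℕP using (_≟_)
  import Data.Fin as F
  open import Data.Vec using (Vec; []; _∷_; toList; lookup; fromList; cast)
  import Data.Vec.Properties as VP
  open import Data.List as L using (List)
  open import Data.List.Membership.Propositional using (_∈_)
  open import Data.List.Membership.DecPropositional _≟_ using (_∈?_)
  open import Data.List.Relation.Unary.Any using (here)
  import Data.List.Relation.Unary.All as All
  open import Data.List.Relation.Unary.Linked using (Linked; [-]) renaming (_∷_ to _∷ˡ_)
  import Data.List.Relation.Unary.Linked as Linked
  open import Data.List.Relation.Unary.Linked.Properties using (Linked⇒All)
  open import Data.List.Relation.Unary.Sorted.TotalOrder.Properties using (↗↭↗⇒≋)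
  open import Data.List.Relation.Binary.Pointwise using (Pointwise-≡⇒≡)
  open import Data.List.Relation.Binary.Permutation.Propositional using (_↭_; ↭-sym; ↭-trans; ↭⇒↭ₛ)
  open import Data.List.Relation.Binary.Permutation.Propositional.Properties using (∈-resp-↭; ↭-length)
  open import Data.Product using (Σ; ∃; _×_; _,_; proj₁; proj₂)
  open import Data.Sum using (_⊎_; inj₁; inj₂)
  open import Data.Empty using (⊥-elim)
  open import Function.Bundles using (_⇔_; mk⇔; Equivalence)
  open import Relation.Nullary using (¬_; Dec; yes; no; does)
  open import Relation.Nullary.Decidable using (map′; _×-dec_; _⊎-dec_; dec-true; dec-false)
  open import Relation.Binary.PropositionalEquality

  inverted? : ∀ l a b → Dec (Inverted l a b)
  inverted? L.[] a b = no λ ()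
  inverted? (x L.∷ l) a b = map′ from to (((x ≟ b) ×-dec (a ∈? l)) ⊎-dec inverted? l a b)
    where
    from : (x ≡ b × a ∈ l) ⊎ Inverted l a b → Inverted (x L.∷ l) a b
    from (inj₁ (refl , a∈l)) = now a∈l
    from (inj₂ inv) = later inv
    to : Inverted (x L.∷ l) a b → (x ≡ b × a ∈ l) ⊎ Inverted l a b
    to (now a∈l) = inj₁ (refl , a∈l)
    to (later inv) = inj₂ inv

  sorted-↭⇒≡ : ∀ {l l′ : List ℕ} → Linked _≤_ l → Linked _≤_ l′ → l ↭ l′ → l ≡ l′
  sorted-↭⇒≡ sorted sorted′ l↭l′ = Pointwise-≡⇒≡ (↗↭↗⇒≋ ℕP.≤-totalOrder sorted sorted′ (↭⇒↭ₛ l↭l′))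

  nondecreasing⇒sorted : ∀ {n} (s : Vec ℕ n) → Nondecreasing s → Linked _≤_ (toList s)
  nondecreasing⇒sorted [] _ = Linked.[]
  nondecreasing⇒sorted (x ∷ []) _ = [-]
  nondecreasing⇒sorted (x ∷ y ∷ s) nd =
    nd F.zero (F.suc F.zero) z≤n ∷ˡ nondecreasing⇒sorted (y ∷ s) (λ i j i≤j → nd (F.suc i) (F.suc j) (s≤s i≤j))

  sorted⇒nondecreasing : ∀ {n} (s : Vec ℕ n) → Linked _≤_ (toList s) → Nondecreasing s
  sorted⇒nondecreasing (x ∷ s) sorted F.zero j _ =
    All.lookup (Linked⇒All ℕP.≤-trans ℕP.≤-refl sorted) (lookup∈toList (x ∷ s) j)
  sorted⇒nondecreasing (x ∷ s) sorted (F.suc i) (F.suc j) (s≤s i≤j) =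
    sorted⇒nondecreasing s (Linked.tail sorted) i j i≤j

  module _ {k : ℕ} where

    wordOf-length : (r : Vec Step k) → L.length (wordOf r) ≡ suc k
    wordOf-length r = trans (↭-length (wordOf-↭ r)) (VP.length-toList (letters 1 r))

    representative : Vec Step k → Word (suc k)
    representative r = cast (wordOf-length r) (fromList (wordOf r))

    toList-representative : ∀ r → toList (representative r) ≡ wordOf r
    toList-representative r = trans (VP.toList-cast (wordOf-length r) (fromList (wordOf r))) (VP.toList∘fromList (wordOf r))

    letters-↭ : ∀ r → toList (letters 1 r) ↭ toList (representative r)
    letters-↭ r = subst (toList (letters 1 r) ↭_) (sym (toList-representative r)) (↭-sym (wordOf-↭ r))

    ascent-true⇒Inverted-rep : ∀ {r a b} → Ascent 1 r a b true → Inverted (toList (representative r)) a b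
    ascent-true⇒Inverted-rep {r} asc =
      subst (λ l → Inverted l _ _) (sym (toList-representative r)) (ascent-true⇒Inverted asc false _ Top-start)

    ascent-false⇒¬Inverted-rep : ∀ {r a b} → Ascent 1 r a b false → ¬ Inverted (toList (representative r)) a b
    ascent-false⇒¬Inverted-rep {r} asc inv =
      ascent-false⇒¬Inverted asc false _ Top-start (subst (λ l → Inverted l _ _) (toList-representative r) inv)

    representative-parking : ∀ r → Admissible 0 r → IsParking (suc k) (representative r)
    representative-parking r adm =
      bounds , letters 1 r , letters-↭ r ,
      sorted⇒nondecreasing (letters 1 r) (letters-sorted 1 r) , letters-bound 1 adm
      where
      bounds : ∀ p → 1 ≤ lookup (representative r) p × lookup (representative r) p ≤ suc k
      bounds p = letters-≥ 1 r ∈letters , letters-≤ 1 adm ∈letters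
        where
        ∈letters = ∈-resp-↭ (↭-sym (letters-↭ r)) (lookup∈toList (representative r) p)

    representative-injective : ∀ r r′ → Hypo (representative r) (representative r′) → r ≡ r′
    representative-injective r r′ hypo = steps-injective 1 r r′ same-letters same-marks
      where
      r↭r′ : toList (representative r) ↭ toList (representative r′)
      r↭r′ = proj₁ (Equivalence.to hypo⇔ hypo)
      same : SameAdjacentInversions (toList (representative r)) (toList (representative r′))
      same = proj₂ (Equivalence.to hypo⇔ hypo)
      same-letters : toList (letters 1 r) ≡ toList (letters 1 r′)
      same-letters = sorted-↭⇒≡ (letters-sorted 1 r) (letters-sorted 1 r′)
        (↭-trans (letters-↭ r) (↭-trans r↭r′ (↭-sym (letters-↭ r′))))
      same-marks : ∀ {a b m m′} → Ascent 1 r a b m → Ascent 1 r′ a b m′ → m ≡ m′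
      same-marks {a} {b} {m} {m′} asc asc′ = marks-agree m m′ asc asc′
        where
        a<b×adjacent = ascent⇒consecutive asc
        inverted⇔ : Inverted (toList (representative r)) a b ⇔ Inverted (toList (representative r′)) a b
        inverted⇔ = same a b (proj₁ a<b×adjacent)
          (λ x x∈ → proj₂ (proj₂ (proj₂ a<b×adjacent)) x (∈-resp-↭ (↭-sym (letters-↭ r)) x∈))
        marks-agree : ∀ m m′ → Ascent 1 r a b m → Ascent 1 r′ a b m′ → m ≡ m′
        marks-agree true true _ _ = refl
        marks-agree false false _ _ = refl
        marks-agree true false asc asc′ =
          ⊥-elim (ascent-false⇒¬Inverted-rep asc′ (Equivalence.to inverted⇔ (ascent-true⇒Inverted-rep asc)))
        marks-agree false true asc asc′ =
          ⊥-elim (ascent-false⇒¬Inverted-rep asc (Equivalence.from inverted⇔ (ascent-true⇒Inverted-rep asc′)))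

  first-sorted-letter : ∀ {n m} (w : Word n) {x} {ys : Vec ℕ m} → (∀ p → 1 ≤ lookup w p) →
    toList (x ∷ ys) ↭ toList w → x ≤ 1 → x ≡ 1
  first-sorted-letter w positive s↭w x≤1 with ∈toList⇒lookup w (∈-resp-↭ s↭w (here refl))
  ... | p , wp≡x = ℕP.≤-antisym x≤1 (subst (1 ≤_) wp≡x (positive p))

  module _ {k : ℕ} where

    representative-surjective : ∀ w → IsParking (suc k) w →
      Σ (Vec Step k) λ r → Admissible 0 r × Hypo w (representative r)
    representative-surjective w (bounds , x ∷ ys , s↭w , nd , bound)
      with first-sorted-letter w (λ p → proj₁ (bounds p)) s↭w (bound F.zero)
    ... | refl = r , stepsFrom-admissible mark 0 1 ys sorted bound , Equivalence.from hypo⇔ (w↭rep , same)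
      where
      mark : ℕ → ℕ → Bool
      mark a b = does (inverted? (toList w) a b)
      sorted : Linked _≤_ (toList (1 ∷ ys))
      sorted = nondecreasing⇒sorted (1 ∷ ys) nd
      r : Vec Step k
      r = stepsFrom mark 1 ys
      w↭letters : toList w ↭ toList (letters 1 r)
      w↭letters = subst (λ zs → toList w ↭ 1 L.∷ toList zs) (sym (climb-stepsFrom mark 1 ys sorted)) (↭-sym s↭w)
      w↭rep : toList w ↭ toList (representative r)
      w↭rep = ↭-trans w↭letters (letters-↭ r)
      ascent : ∀ {a b} → a < b → Adjacent (toList w) a b → a ∈ toList w → b ∈ toList w →
        ∃ λ m → Ascent 1 r a b m
      ascent a<b adjacent a∈ b∈ = consecutive⇒ascent 1 r
        (a<b , ∈-resp-↭ w↭letters a∈ , ∈-resp-↭ w↭letters b∈ ,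
         λ x x∈ → adjacent x (∈-resp-↭ (↭-sym w↭letters) x∈))
      marked : ∀ {a b m} → Ascent 1 r a b m → m ≡ mark a b
      marked = stepsFrom-marks mark 1 ys sorted
      same : SameAdjacentInversions (toList w) (toList (representative r))
      same a b a<b adjacent = mk⇔ to from
        where
        to : Inverted (toList w) a b → Inverted (toList (representative r)) a b
        to inv with ascent a<b adjacent (proj₁ (Inverted-∈ inv)) (proj₂ (Inverted-∈ inv))
        ... | m , asc =
          ascent-true⇒Inverted-rep (subst (Ascent 1 r a b) (trans (marked asc) (dec-true (inverted? _ a b) inv)) asc)
        from : Inverted (toList (representative r)) a b → Inverted (toList w) a b
        from inv-rep with inverted? (toList w) a b
        ... | yes inv = inv
        ... | no ¬inv with ascent a<b adjacent (∈-resp-↭ (↭-sym w↭rep) (proj₁ (Inverted-∈ inv-rep)))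
                                             (∈-resp-↭ (↭-sym w↭rep) (proj₂ (Inverted-∈ inv-rep)))
        ...   | m , asc = ⊥-elim (ascent-false⇒¬Inverted-rep
          (subst (Ascent 1 r a b) (trans (marked asc) (dec-false (inverted? _ a b) ¬inv)) asc) inv-rep)

open SchroederFormula using (schroeder-paths)
open Enumeration using (paths-↔; AdmissibleSteps-≡)
open Representatives

ParkingTransversal : ℕ → ℕ → Set
ParkingTransversal n N =
  Σ (Fin N → Word n) λ rep →
    ((i : Fin N) → IsParking n (rep i)) ×
    ((i j : Fin N) → Hypo (rep i) (rep j) → i ≡ j) ×
    ((w : Word n) → IsParking n w → ∃ λ i → Hypo w (rep i))

transversal-via-↔ : ∀ {N n} {A : Set} → Fin N ↔ A → (f : A → Word n) →
  (∀ a → IsParking n (f a)) → (∀ a b → Hypo (f a) (f b) → a ≡ b) →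
  (∀ w → IsParking n w → ∃ λ a → Hypo w (f a)) → ParkingTransversal n N
transversal-via-↔ enum f parking injective surjective =
  f ∘ to , parking ∘ to , to-injective , λ w pk → from-witness (surjective w pk)
  where
  open Inverse enum
  to-injective : ∀ i j → Hypo (f (to i)) (f (to j)) → i ≡ j
  to-injective i j hypo = trans (sym (strictlyInverseʳ i)) (trans (cong from (injective _ _ hypo)) (strictlyInverseʳ j))
  from-witness : ∀ {w} → ∃ (λ a → Hypo w (f a)) → ∃ λ i → Hypo w (f (to i))
  from-witness (a , hypo) = from a , subst (Hypo _ ∘ f) (sym (strictlyInverseˡ a)) hypo

mainTheorem6 : (n : ℕ) → 1 ≤ n →
    Σ (Fin (schroeder n) → Word n) λ rep →
      ((i : Fin (schroeder n)) → IsParking n (rep i)) ×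
      ((i j : Fin (schroeder n)) → Hypo (rep i) (rep j) → i ≡ j) ×
      ((w : Word n) → IsParking n w → ∃ λ i → Hypo w (rep i))
mainTheorem6 zero ()
mainTheorem6 (suc k) _ =
  subst (ParkingTransversal (suc k)) (sym (schroeder-paths k))
    (transversal-via-↔ (paths-↔ k 0) (representative ∘ proj₁)
      (λ (r , adm) → representative-parking r adm)
      (λ s s′ hypo → AdmissibleSteps-≡ (representative-injective (proj₁ s) (proj₁ s′) hypo))
      (λ w pk → let r , adm , hypo = representative-surjective w pk in (r , adm) , hypo))
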